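{- Let $M$ be a finite geometric semilattice of rank $n$, and let $cM$, $\underline{M}$ and, for $S\in\underline{M}$, the posets $\underline{M}^S$ and $M_S$ be as defined in the context. Then \[ \chi_M(t)=\sum_{S\in\underline{M}}\chi_{\underline{M}^S}(t)\,\chi_{M_S}(1). \]
   Context: A ranked lattice $L$ is semimodular if $\operatorname{rank}(s)+\operatorname{rank}(t)\ge \operatorname{rank}(s\wedge t)+\operatorname{rank}(s\vee t)$ for all $s,t$; it is atomistic if every element is a join of atoms; a geometric lattice is a (finite) semimodular atomistic ranked lattice. For a ranked meet semilattice $M$, a set $S$ of atoms is independent if it has a join $\bigvee S$ and $\operatorname{rank}(\bigvee S)=|S|$. $M$ is a geometric semilattice if (a) every principal order ideal of $M$ is a geometric lattice, and (b) whenever $S$ is an independent set of atoms and $\operatorname{rank}(t)<\operatorname{rank}(\bigvee S)$, there is $a\in S$ with $a\not\le t$ such that $t\vee a$ exists. Cone and centralization: let $A=\{a_1,\dots,a_k\}$ be the atoms of $M$ and $a_0$ a new symbol. For $s\in M$ let $A_s=\{a\in A: a\le s\}$, $P_s=\{a\in A: a \text{ and } s \text{ have no common upper bound in } M\}$, and $\underline{A_s}=A_s\cup P_s\cup\{a_0\}$. The cone is $cM=\{A_s:s\in M\}\cup\{\underline{A_s}:s\in M\}$ ordered by inclusion (a geometric lattice), and the centralization is the subposet $\underline{M}=\{\underline{A_s}:s\in M\}$. For $S\in\underline{M}$, $\underline{M}^S=\{T\in\underline{M}: S\subseteq T\}$ (principal order filter), and $M_S=\{X\in cM: X\subseteq S\}\setminus\underline{M}$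 (the localization). For a (semi)lattice $P$ with minimum $\hat 0$ and rank $N$ (maximum rank of an element, ranks measured from $\hat0$), its characteristic polynomial is $\chi_P(t)=\sum_{s\in P}\mu_P(\hat 0,s)\,t^{N-\operatorname{rank}(s)}$, with $\mu_P$ the Möbius function of $P$. -}

module Defs where

open import Level using (0ℓ)
open import Data.Nat as ℕ using (ℕ; zero; suc; _+_; _∸_; _≤_; _<_; _⊔_)
open import Data.Integer as ℤ using (ℤ; 0ℤ; 1ℤ; -_) renaming (_+_ to _+ℤ_; _*_ to _*ℤ_; _^_ to _^ℤ_)
open import Data.Fin using (Fin; zero; suc)
open import Data.Fin.Properties using (any?; all?) renaming (_≟_ to _≟Fin_)
open import Data.Fin.Subset as Sub using (Subset; ∣_∣; inside; outside) renaming (_∈_ to _∈ˢ_; _⊆_ to _⊆ˢ_)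
open import Data.Fin.Subset.Properties using (_⊆?_)
open import Data.Bool using (Bool; true; false; _∧_; _∨_)
open import Data.Vec as Vec using (Vec; []; _∷_; tabulate)
import Data.Vec.Properties as VecP
open import Data.Bool.Properties using () renaming (_≟_ to _≟B_)
open import Data.List as List using (List; []; _∷_; map; filter; foldr; allFin; length)
open import Data.Product using (Σ; ∃; _×_; _,_)
open import Data.Sum using (_⊎_)
open import Relation.Nullary using (¬_; Dec; yes; no; does; ¬?)
open import Relation.Nullary.Decidable using (_×-dec_; _⊎-dec_; _→-dec_)
open import Relation.Binary using (Rel; Decidable; DecidableEquality; IsPartialOrder)
open import Relation.Binary.PropositionalEquality using (_≡_; _≢_)
open import Relation.Binary.Lattice using (IsMeetSemilattice)

record FinitePoset : Set₁ where
  field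
    Carrier  : Set
    _≼_      : Carrier → Carrier → Set
    _≼?_     : Decidable _≼_
    _≟_      : DecidableEquality Carrier
    elements : List Carrier

sumℤ : List ℤ → ℤ
sumℤ = foldr _+ℤ_ 0ℤ

maxℕ : List ℕ → ℕ
maxℕ = foldr _⊔_ 0

module FP (P : FinitePoset) where
  open FinitePoset P

  _≺?_ : (x y : Carrier) → Dec (x ≼ y × ¬ (x ≡ y))
  x ≺? y = (x ≼? y) ×-dec ¬? (x ≟ y)

  fuel : ℕ
  fuel = length elements

  -- Möbius function μ(x,y) by the defining recursion
  --   μ(x,x) = 1,  μ(x,y) = - Σ_{x ≤ z < y} μ(x,z) for x < y,  0 otherwise;
  -- the fuel argument bounds the recursion depth (chain length + 1),
  -- and `length elements` fuel always suffices.
  μ′ : ℕ → Carrier → Carrier → ℤ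
  μ′ zero    x y = 0ℤ
  μ′ (suc k) x y with x ≟ y
  ... | yes _ = 1ℤ
  ... | no _ with x ≼? y
  ...   | no _  = 0ℤ
  ...   | yes _ = - sumℤ (map (μ′ k x)
                     (filter (λ z → (x ≼? z) ×-dec (z ≺? y)) elements))

  μ : Carrier → Carrier → ℤ
  μ = μ′ fuel

  -- height of s: length of a longest chain of P ending at s
  -- (for a poset with minimum 0̂ this is the rank of s measured from 0̂)
  height′ : ℕ → Carrier → ℕ
  height′ zero    s = 0
  height′ (suc k) s = maxℕ (map (λ z → suc (height′ k z))
                              (filter (λ z → z ≺? s) elements))

  rank : Carrier → ℕ
  rank = height′ fuel

  rankP : ℕ
  rankP = maxℕ (map rank elements)

  χ : (0̂ : Carrier) → ℤ → ℤ
  χ 0̂ t = sumℤ (map (λ s → μ 0̂ s *ℤ (t ^ℤ (rankP ∸ rank s))) elements)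

record RankedMeetSemilattice (m : ℕ) : Set₁ where
  field
    _≤M_              : Rel (Fin m) 0ℓ
    _≤M?_             : Decidable _≤M_
    _∧M_              : Fin m → Fin m → Fin m
    isMeetSemilattice : IsMeetSemilattice _≡_ _≤M_ _∧M_
    ⊥M                : Fin m
    ⊥M-min            : ∀ x → ⊥M ≤M x

  _⋖_ : Fin m → Fin m → Set
  x ⋖ y = x ≤M y × x ≢ y × (∀ z → x ≤M z → z ≤M y → z ≡ x ⊎ z ≡ y)

  field
    rk     : Fin m → ℕ
    rk-⊥   : rk ⊥M ≡ 0
    rk-⋖   : ∀ {x y} → x ⋖ y → rk y ≡ suc (rk x)

  _⋖?_ : Decidable _⋖_
  x ⋖? y = (x ≤M? y) ×-dec (¬? (x ≟Fin y) ×-dec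
            all? (λ z → (x ≤M? z) →-dec ((z ≤M? y) →-dec ((z ≟Fin x) ⊎-dec (z ≟Fin y)))))

  IsAtom : Fin m → Set
  IsAtom a = ⊥M ⋖ a

  atom? : (a : Fin m) → Dec (IsAtom a)
  atom? a = ⊥M ⋖? a

  IsJoin : Fin m → Fin m → Fin m → Set
  IsJoin x y j = x ≤M j × y ≤M j × (∀ u → x ≤M u → y ≤M u → j ≤M u)

  IsJoinBelow : Fin m → Fin m → Fin m → Fin m → Set
  IsJoinBelow s x y j = j ≤M s × x ≤M j × y ≤M j
                        × (∀ u → u ≤M s → x ≤M u → y ≤M u → j ≤M u)

  IsJoinOf : Subset m → Fin m → Set
  IsJoinOf S j = (∀ a → a ∈ˢ S → a ≤M j) × (∀ u → (∀ a → a ∈ˢ S → a ≤M u) → j ≤M u)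

  IsJoinOfBelow : Fin m → Subset m → Fin m → Set
  IsJoinOfBelow s S j = j ≤M s × (∀ a → a ∈ˢ S → a ≤M j)
                        × (∀ u → u ≤M s → (∀ a → a ∈ˢ S → a ≤M u) → j ≤M u)

  NoCommonUB : Fin m → Fin m → Set
  NoCommonUB a s = ¬ (∃ λ u → a ≤M u × s ≤M u)

  noCommonUB? : ∀ a s → Dec (NoCommonUB a s)
  noCommonUB? a s = ¬? (any? (λ u → (a ≤M? u) ×-dec (s ≤M? u)))

module _ {m : ℕ} (M : RankedMeetSemilattice m) where
  open RankedMeetSemilattice M

  IdealIsGeometricLattice : Fin m → Set
  IdealIsGeometricLattice s =
      -- lattice: joins exist inside the ideal (meets are those of M)
      (∀ x y → x ≤M s → y ≤M s → ∃ λ j → IsJoinBelow s x y j)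
    ×
      (∀ x y j → x ≤M s → y ≤M s → IsJoinBelow s x y j →
         rk (x ∧M y) + rk j ≤ rk x + rk y)
    ×
      (∀ x → x ≤M s → ∃ λ (S : Subset m) →
         (∀ a → a ∈ˢ S → IsAtom a) × IsJoinOfBelow s S x)

  IndependentWithJoin : Subset m → Fin m → Set
  IndependentWithJoin S j =
    (∀ a → a ∈ˢ S → IsAtom a) × IsJoinOf S j × rk j ≡ ∣ S ∣

  record IsGeometricSemilattice : Set where
    field
      ideals    : ∀ s → IdealIsGeometricLattice s
      augmented : ∀ S j → IndependentWithJoin S j → ∀ t → rk t < rk j →
                  ∃ λ a → a ∈ˢ S × ¬ (a ≤M t) × ∃ λ v → IsJoin t a v

-- Cone, centralization, filters and localizations
-- Subsets of {a₀} ∪ A are encoded as Subset (suc m): index zero is a₀,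
-- index suc i is the element i of M (only atoms are ever included).

allSubsets : (n : ℕ) → List (Subset n)
allSubsets zero    = [] ∷ []
allSubsets (suc n) = map (outside ∷_) (allSubsets n) List.++ map (inside ∷_) (allSubsets n)

_≟ˢ_ : ∀ {n} → DecidableEquality (Subset n)
_≟ˢ_ = VecP.≡-dec _≟B_

module Cone {m : ℕ} (M : RankedMeetSemilattice m) where
  open RankedMeetSemilattice M

  A : Fin m → Subset (suc m)
  A s = outside ∷ tabulate (λ a → does (atom? a) ∧ does (a ≤M? s))

  -- A_s ∪ P_s ∪ {a₀}
  A̲ : Fin m → Subset (suc m)
  A̲ s = inside ∷ tabulate (λ a → does (atom? a) ∧ (does (a ≤M? s) ∨ does (noCommonUB? a s)))

  InCone : Subset (suc m) → Set
  InCone X = ∃ λ s → X ≡ A s ⊎ X ≡ A̲ s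

  inCone? : (X : Subset (suc m)) → Dec (InCone X)
  inCone? X = any? (λ s → (X ≟ˢ A s) ⊎-dec (X ≟ˢ A̲ s))

  InCentral : Subset (suc m) → Set
  InCentral X = ∃ λ s → X ≡ A̲ s

  inCentral? : (X : Subset (suc m)) → Dec (InCentral X)
  inCentral? X = any? (λ s → X ≟ˢ A̲ s)

  Mposet : FinitePoset
  Mposet = record { Carrier = Fin m ; _≼_ = _≤M_ ; _≼?_ = _≤M?_
                  ; _≟_ = _≟Fin_ ; elements = allFin m }

  subsetPoset : List (Subset (suc m)) → FinitePoset
  subsetPoset xs = record { Carrier = Subset (suc m) ; _≼_ = _⊆ˢ_ ; _≼?_ = _⊆?_
                          ; _≟_ = _≟ˢ_ ; elements = xs }

  centralElems : List (Subset (suc m))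
  centralElems = filter inCentral? (allSubsets (suc m))

  filterPoset : Subset (suc m) → FinitePoset
  filterPoset S = subsetPoset (filter (λ T → inCentral? T ×-dec (S ⊆? T)) (allSubsets (suc m)))

  localPoset : Subset (suc m) → FinitePoset
  localPoset S = subsetPoset (filter (λ X → inCone? X ×-dec ((X ⊆? S) ×-dec ¬? (inCentral? X)))
                                     (allSubsets (suc m)))

{-# OPTIONS --safe #-}
module Submission where

-- Write μ for Möbius functions, n for the rank of M and ρ(A̲ s) = rk s + 1 for the rank of
-- A̲ s in the cone. The localization M_S consists of the sets A_s ⊆ S, and s ↦ A_s is an order
-- embedding, so χ_{M_S}(1) = Σ_{A_s ⊆ S} μ_M(0̂, s). The filter M̲^S is ranked by ρ − ρ(S), so
-- χ_{M̲^S}(t) = Σ_{T ⊇ S} μ(S, T) t^{n + 1 − ρ(T)}. Expanding the right-hand side and summing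
-- over S first, the closure property (A_s ⊆ S ⇔ A̲_s ⊆ S for S ∈ M̲) turns the innermost sum into
-- Σ_{A̲_s ⊆ S ⊆ T} μ(S, T) = δ(A̲_s, T), which leaves Σ_s μ_M(0̂, s) t^{n − rk s} = χ_M(t).
-- The closure property and the rank computations come from the augmentation axiom through
-- exchange arguments with independent sets of atoms.

open import Defs
open import Data.Nat using (ℕ)
open import Data.Integer using (ℤ; 1ℤ) renaming (_*_ to _*ℤ_)
open import Data.List using (map)
open import Data.Fin.Subset using () renaming (⊥ to ∅)
open import Relation.Binary.PropositionalEquality using (_≡_)

open import Data.Bool using (Bool; true; if_then_else_)
open import Data.Empty using (⊥-elim) renaming (⊥ to False)
open import Data.Fin using (Fin; zero; suc)
open import Data.Fin.Properties using (any?; ¬∀⟶∃¬) renaming (_≟_ to _≟Fin_)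
open import Data.Fin.Subset using (Subset; ∣_∣; inside; outside; _∪_; ⁅_⁆) renaming (_∈_ to _∈ˢ_; _⊆_ to _⊆ˢ_)
open import Data.Fin.Subset.Properties
  using (_∈?_; _⊆?_; x∈p∪q⁻; x∈p∪q⁺; x∈⁅x⁆; x∈⁅y⁆⇒x≡y; ∉⊥; ∣⊥∣≡0; ⊥⊆; ∪-identityʳ
        ; ⊆-refl; ⊆-reflexive; ⊆-trans; ⊆-antisym; ⊆-isPartialOrder)
open import Data.Integer using (0ℤ; -_) renaming (_+_ to _+ℤ_; _^_ to _^ℤ_)
import Data.Integer.Properties as ℤ
open import Data.List using (List; []; _∷_; filter; length; allFin)
open import Data.List.Membership.Propositional using (_∈_)
open import Data.List.Membership.Propositional.Properties
  using (∈-filter⁺; ∈-filter⁻; ∈-map⁺; ∈-map⁻; ∈-allFin; ∈-++⁺ˡ; ∈-++⁺ʳ)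
open import Data.List.Membership.Propositional.Properties.WithK using (unique∧set⇒bag)
import Data.List.Properties as List
open import Data.List.Relation.Binary.BagAndSetEquality using (∼bag⇒↭)
open import Data.List.Relation.Binary.Permutation.Propositional using (_↭_; ↭⇒↭ₛ)
open import Data.List.Relation.Binary.Permutation.Propositional.Properties using (↭-length) renaming (map⁺ to ↭-map⁺)
open import Data.List.Relation.Unary.All as All using ([])
open import Data.List.Relation.Unary.AllPairs using ([]; _∷_)
open import Data.List.Relation.Unary.Any as Any using (here; there)
open import Data.List.Relation.Unary.Unique.Propositional using (Unique)
import Data.List.Relation.Unary.Unique.Propositional.Properties as Unique
open import Data.Nat using (zero; suc; _+_; _∸_; _≤_; _<_; z≤n; s≤s; _<?_)
import Data.Nat.Properties as ℕ
open import Data.Product using (∃; _×_; _,_; proj₁; proj₂)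
open import Data.Sum using (_⊎_; inj₁; inj₂)
open import Data.Vec as Vec using ([]; _∷_)
import Data.Vec.Properties as Vec
open import Function using (_∘_; id)
open import Function.Bundles using (mk⇔)
open import Level using (Level)
open import Relation.Binary using (IsPartialOrder)
open import Relation.Binary.Lattice using (IsMeetSemilattice)
open import Relation.Binary.PropositionalEquality using (refl; sym; trans; cong; cong₂; subst; subst₂; setoid; module ≡-Reasoning)
open import Relation.Nullary using (¬_; Dec; yes; no; does; ¬?)
open import Relation.Nullary.Decidable using (_×-dec_; _⊎-dec_; _→-dec_; toSum; dec-true)
open import Relation.Unary using (Pred; Decidable)

open import Data.List.Relation.Binary.Permutation.Setoid.Properties (setoid ℤ) using (foldr-commMonoid)
open import Algebra.Properties.CommutativeSemigroup ℤ.+-commutativeSemigroup using (interchange)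

open ≡-Reasoning

-- Finite sums of integers over lists

∑ : ∀ {a} {A : Set a} → List A → (A → ℤ) → ℤ
∑ xs f = sumℤ (map f xs)

when : ∀ {p} {P : Set p} → Dec P → ℤ → ℤ
when P? v = if does P? then v else 0ℤ

module _ {a} {A : Set a} where

  ∑-cong : ∀ xs {f g : A → ℤ} → (∀ {x} → x ∈ xs → f x ≡ g x) → ∑ xs f ≡ ∑ xs g
  ∑-cong xs f≗g = cong sumℤ (List.map-cong-local (All.tabulate f≗g))

  ∑-zero : ∀ xs {f : A → ℤ} → (∀ {x} → x ∈ xs → f x ≡ 0ℤ) → ∑ xs f ≡ 0ℤ
  ∑-zero []       f≗0 = refl
  ∑-zero (x ∷ xs) f≗0 = cong₂ _+ℤ_ (f≗0 (here refl)) (∑-zero xs (f≗0 ∘ there))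

  ∑-+ : ∀ xs (f g : A → ℤ) → ∑ xs (λ x → f x +ℤ g x) ≡ ∑ xs f +ℤ ∑ xs g
  ∑-+ []       f g = refl
  ∑-+ (x ∷ xs) f g = trans (cong (f x +ℤ g x +ℤ_) (∑-+ xs f g)) (interchange (f x) (g x) _ _)

  ∑-*ˡ : ∀ xs c (f : A → ℤ) → c *ℤ ∑ xs f ≡ ∑ xs (λ x → c *ℤ f x)
  ∑-*ˡ []       c f = ℤ.*-zeroʳ c
  ∑-*ˡ (x ∷ xs) c f = trans (ℤ.*-distribˡ-+ c (f x) _) (cong (c *ℤ f x +ℤ_) (∑-*ˡ xs c f))

  ∑-*ʳ : ∀ xs c (f : A → ℤ) → ∑ xs f *ℤ c ≡ ∑ xs (λ x → f x *ℤ c)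
  ∑-*ʳ []       c f = ℤ.*-zeroˡ c
  ∑-*ʳ (x ∷ xs) c f = trans (ℤ.*-distribʳ-+ c (f x) _) (cong (f x *ℤ c +ℤ_) (∑-*ʳ xs c f))

  ∑-neg : ∀ xs (f : A → ℤ) → - ∑ xs f ≡ ∑ xs (λ x → - f x)
  ∑-neg []       f = refl
  ∑-neg (x ∷ xs) f = trans (ℤ.neg-distrib-+ (f x) _) (cong (- f x +ℤ_) (∑-neg xs f))

  ∑-↭ : ∀ {xs ys} (f : A → ℤ) → xs ↭ ys → ∑ xs f ≡ ∑ ys f
  ∑-↭ f xs↭ys = foldr-commMonoid ℤ.+-0-isCommutativeMonoid (↭⇒↭ₛ (↭-map⁺ f xs↭ys))

  ∑-filter : ∀ {p} {P : Pred A p} (P? : Decidable P) xs (f : A → ℤ) →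
             ∑ (filter P? xs) f ≡ ∑ xs (λ x → when (P? x) (f x))
  ∑-filter P? []       f = refl
  ∑-filter P? (x ∷ xs) f with P? x
  ... | yes _ = cong (f x +ℤ_) (∑-filter P? xs f)
  ... | no  _ = trans (∑-filter P? xs f) (sym (ℤ.+-identityˡ _))

  ∑-single : ∀ {xs} {f : A → ℤ} {x} → Unique xs → x ∈ xs →
             (∀ {y} → y ∈ xs → ¬ y ≡ x → f y ≡ 0ℤ) → ∑ xs f ≡ f x
  ∑-single {y ∷ xs} {f} (y∉xs ∷ _) (here refl) f≗0 =
    trans (cong (f y +ℤ_) (∑-zero xs (λ z∈xs → f≗0 (there z∈xs) (All.lookup y∉xs z∈xs ∘ sym))))
          (ℤ.+-identityʳ (f y))
  ∑-single {y ∷ xs} {f} (y∉xs ∷ uxs) (there x∈xs) f≗0 =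
    trans (cong (_+ℤ ∑ xs f) (f≗0 (here refl) (All.lookup y∉xs x∈xs)))
          (trans (ℤ.+-identityˡ _) (∑-single uxs x∈xs (f≗0 ∘ there)))

  same-members⇒↭ : ∀ {xs ys : List A} → Unique xs → Unique ys →
                   (∀ {x} → x ∈ xs → x ∈ ys) → (∀ {x} → x ∈ ys → x ∈ xs) → xs ↭ ys
  same-members⇒↭ uxs uys xs⊆ys ys⊆xs = ∼bag⇒↭ (unique∧set⇒bag uxs uys (mk⇔ xs⊆ys ys⊆xs))

module _ {a b} {A : Set a} {B : Set b} where

  ∑-map : ∀ xs (g : A → B) (f : B → ℤ) → ∑ (map g xs) f ≡ ∑ xs (f ∘ g)
  ∑-map xs g f = cong sumℤ (sym (List.map-∘ xs))

  ∑-swap : ∀ xs ys (f : A → B → ℤ) → ∑ xs (λ x → ∑ ys (f x)) ≡ ∑ ys (λ y → ∑ xs (λ x → f x y))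
  ∑-swap []       ys f = sym (∑-zero ys (λ _ → refl))
  ∑-swap (x ∷ xs) ys f = trans (cong (∑ ys (f x) +ℤ_) (∑-swap xs ys f)) (sym (∑-+ ys (f x) _))

  ∑-*-∑ : ∀ xs ys (f : A → ℤ) (g : B → ℤ) → ∑ xs f *ℤ ∑ ys g ≡ ∑ xs (λ x → ∑ ys (λ y → f x *ℤ g y))
  ∑-*-∑ xs ys f g = trans (∑-*ʳ xs (∑ ys g) f) (∑-cong xs (λ {x} _ → ∑-*ˡ ys (f x) g))

∑-swap₃ : ∀ {a b c} {A : Set a} {B : Set b} {C : Set c} xs ys zs (f : A → B → C → ℤ) →
          ∑ xs (λ x → ∑ ys (λ y → ∑ zs (f x y))) ≡ ∑ zs (λ z → ∑ ys (λ y → ∑ xs (λ x → f x y z)))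
∑-swap₃ xs ys zs f = begin
  ∑ xs (λ x → ∑ ys (λ y → ∑ zs (f x y)))           ≡⟨ ∑-cong xs (λ {x} _ → ∑-swap ys zs (f x)) ⟩
  ∑ xs (λ x → ∑ zs (λ z → ∑ ys (λ y → f x y z)))   ≡⟨ ∑-swap xs zs _ ⟩
  ∑ zs (λ z → ∑ xs (λ x → ∑ ys (λ y → f x y z)))   ≡⟨ ∑-cong zs (λ {z} _ → ∑-swap xs ys (λ x y → f x y z)) ⟩
  ∑ zs (λ z → ∑ ys (λ y → ∑ xs (λ x → f x y z)))   ∎

module _ {p} {P : Set p} where

  when-yes : (P? : Dec P) → P → ∀ v → when P? v ≡ v
  when-yes (yes _) _  v = refl
  when-yes (no ¬p) p′ v = ⊥-elim (¬p p′)

  when-no : (P? : Dec P) → ¬ P → ∀ v → when P? v ≡ 0ℤ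
  when-no (yes p) ¬p v = ⊥-elim (¬p p)
  when-no (no _)  _  v = refl

  when-0 : (P? : Dec P) → when P? 0ℤ ≡ 0ℤ
  when-0 (yes _) = refl
  when-0 (no _)  = refl

  when-cong : (P? : Dec P) {v w : ℤ} → (P → v ≡ w) → when P? v ≡ when P? w
  when-cong (yes p) v≡w = v≡w p
  when-cong (no _)  _   = refl

  when-neg : (P? : Dec P) → ∀ v → when P? (- v) ≡ - when P? v
  when-neg (yes _) v = refl
  when-neg (no _)  v = refl

  when-∑ : ∀ {a} {A : Set a} (P? : Dec P) xs (f : A → ℤ) → when P? (∑ xs f) ≡ ∑ xs (λ x → when P? (f x))
  when-∑ (yes _) xs f = refl
  when-∑ (no _)  xs f = sym (∑-zero xs (λ _ → refl))

module _ {p q} {P : Set p} {Q : Set q} where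

  when-× : (P? : Dec P) (Q? : Dec Q) → ∀ v → when (P? ×-dec Q?) v ≡ when P? (when Q? v)
  when-× (yes _) (yes _) v = refl
  when-× (yes _) (no _)  v = refl
  when-× (no _)  _       v = refl

  when-⇔ : (P? : Dec P) (Q? : Dec Q) → (P → Q) → (Q → P) → ∀ v → when P? v ≡ when Q? v
  when-⇔ (yes _) (yes _) _   _   v = refl
  when-⇔ (yes p) (no ¬q) p⇒q _   v = ⊥-elim (¬q (p⇒q p))
  when-⇔ (no ¬p) (yes q) _   q⇒p v = ⊥-elim (¬p (q⇒p q))
  when-⇔ (no _)  (no _)  _   _   v = refl

  when-when-disjoint : (P? : Dec P) (Q? : Dec Q) → (P → Q → False) → ∀ v → when P? (when Q? v) ≡ 0ℤ
  when-when-disjoint (yes p) (yes q) p⇒¬q v = ⊥-elim (p⇒¬q p q)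
  when-when-disjoint (yes _) (no _)  _    v = refl
  when-when-disjoint (no _)  _       _    v = refl

  when-*-when : (P? : Dec P) (Q? : Dec Q) → ∀ a b c → when P? (a *ℤ b) *ℤ when Q? c ≡ (c *ℤ b) *ℤ when Q? (when P? a)
  when-*-when (yes _) (yes _) a b c = trans (ℤ.*-comm (a *ℤ b) c) (trans (cong (c *ℤ_) (ℤ.*-comm a b)) (sym (ℤ.*-assoc c b a)))
  when-*-when (yes _) (no _)  a b c = trans (ℤ.*-zeroʳ (a *ℤ b)) (sym (ℤ.*-zeroʳ (c *ℤ b)))
  when-*-when (no _)  (yes _) a b c = sym (ℤ.*-zeroʳ (c *ℤ b))
  when-*-when (no _)  (no _)  a b c = sym (ℤ.*-zeroʳ (c *ℤ b))

module _ {p q r s} {P : Set p} {Q : Set q} {R : Set r} {S : Set s} where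

  when⁴ : Dec P → Dec Q → Dec R → Dec S → ℤ → ℤ
  when⁴ P? Q? R? S? v = when P? (when Q? (when R? (when S? v)))

  when⁴-as-× : (P? : Dec P) (Q? : Dec Q) (R? : Dec R) (S? : Dec S) → ∀ v →
               when⁴ P? Q? R? S? v ≡ when (P? ×-dec (Q? ×-dec (R? ×-dec S?))) v
  when⁴-as-× P? Q? R? S? v = sym (begin
    when (P? ×-dec (Q? ×-dec (R? ×-dec S?))) v   ≡⟨ when-× P? (Q? ×-dec (R? ×-dec S?)) v ⟩
    when P? (when (Q? ×-dec (R? ×-dec S?)) v)    ≡⟨ cong (when P?) (when-× Q? (R? ×-dec S?) v) ⟩
    when P? (when Q? (when (R? ×-dec S?) v))     ≡⟨ cong (when P? ∘ when Q?) (when-× R? S? v) ⟩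
    when⁴ P? Q? R? S? v                          ∎)

module _ {p q r s p′ q′ r′ s′} {P : Set p} {Q : Set q} {R : Set r} {S : Set s}
         {P′ : Set p′} {Q′ : Set q′} {R′ : Set r′} {S′ : Set s′} where

  when⁴-⇔ : (P? : Dec P) (Q? : Dec Q) (R? : Dec R) (S? : Dec S)
            (P′? : Dec P′) (Q′? : Dec Q′) (R′? : Dec R′) (S′? : Dec S′) →
            (P × Q × R × S → P′ × Q′ × R′ × S′) → (P′ × Q′ × R′ × S′ → P × Q × R × S) →
            ∀ v → when⁴ P? Q? R? S? v ≡ when⁴ P′? Q′? R′? S′? v
  when⁴-⇔ P? Q? R? S? P′? Q′? R′? S′? to from v = begin
    when⁴ P? Q? R? S? v                             ≡⟨ when⁴-as-× P? Q? R? S? v ⟩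
    when PQRS? v                                    ≡⟨ when-⇔ PQRS? P′Q′R′S′? to from v ⟩
    when P′Q′R′S′? v                                ≡⟨ sym (when⁴-as-× P′? Q′? R′? S′? v) ⟩
    when⁴ P′? Q′? R′? S′? v                         ∎
    where
    PQRS?    = P? ×-dec (Q? ×-dec (R? ×-dec S?))
    P′Q′R′S′? = P′? ×-dec (Q′? ×-dec (R′? ×-dec S′?))

-- Filters and maxima of lists

module _ {a} {A : Set a} {p q} {P : Pred A p} {Q : Pred A q} (P? : Decidable P) (Q? : Decidable Q) where

  length-filter-mono : ∀ xs → (∀ {x} → P x → Q x) → length (filter P? xs) ≤ length (filter Q? xs)
  length-filter-mono []       P⇒Q = z≤n
  length-filter-mono (x ∷ xs) P⇒Q with P? x | Q? x
  ... | yes _  | yes _  = s≤s (length-filter-mono xs P⇒Q)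
  ... | yes px | no ¬qx = ⊥-elim (¬qx (P⇒Q px))
  ... | no _   | yes _  = ℕ.m≤n⇒m≤1+n (length-filter-mono xs P⇒Q)
  ... | no _   | no _   = length-filter-mono xs P⇒Q

  length-filter-strictMono : ∀ xs → (∀ {x} → P x → Q x) → ∀ {y} → y ∈ xs → Q y → ¬ P y →
                             length (filter P? xs) < length (filter Q? xs)
  length-filter-strictMono (x ∷ xs) P⇒Q (here refl) qy ¬py with P? x | Q? x
  ... | yes py | _      = ⊥-elim (¬py py)
  ... | no _   | yes _  = s≤s (length-filter-mono xs P⇒Q)
  ... | no _   | no ¬qy = ⊥-elim (¬qy qy)
  length-filter-strictMono (x ∷ xs) P⇒Q (there y∈xs) qy ¬py with P? x | Q? x
  ... | yes _  | yes _  = s≤s (length-filter-strictMono xs P⇒Q y∈xs qy ¬py)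
  ... | yes px | no ¬qx = ⊥-elim (¬qx (P⇒Q px))
  ... | no _   | yes _  = ℕ.m≤n⇒m≤1+n (length-filter-strictMono xs P⇒Q y∈xs qy ¬py)
  ... | no _   | no _   = length-filter-strictMono xs P⇒Q y∈xs qy ¬py

  filter-filter : ∀ xs → filter P? (filter Q? xs) ≡ filter (λ x → Q? x ×-dec P? x) xs
  filter-filter []       = refl
  filter-filter (x ∷ xs) with Q? x
  ... | no  _ = filter-filter xs
  ... | yes _ with P? x
  ...   | yes _ = cong (x ∷_) (filter-filter xs)
  ...   | no  _ = filter-filter xs

length-filter-< : ∀ {a p} {A : Set a} {P : Pred A p} (P? : Decidable P) xs {y} → y ∈ xs → ¬ P y →
                  length (filter P? xs) < length xs
length-filter-< P? xs y∈xs ¬py = List.filter-notAll P? xs (Any.map (λ { refl → ¬py }) y∈xs)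

maxℕ-upper : ∀ {xs n} → n ∈ xs → n ≤ maxℕ xs
maxℕ-upper         (here refl)  = ℕ.m≤m⊔n _ _
maxℕ-upper {x ∷ _} (there n∈xs) = ℕ.≤-trans (maxℕ-upper n∈xs) (ℕ.m≤n⊔m x _)

maxℕ-least : ∀ xs {b} → (∀ {n} → n ∈ xs → n ≤ b) → maxℕ xs ≤ b
maxℕ-least []       _   = z≤n
maxℕ-least (x ∷ xs) ≤b = ℕ.⊔-lub (≤b (here refl)) (maxℕ-least xs (≤b ∘ there))

maxℕ-attained : ∀ xs → maxℕ xs ≡ 0 ⊎ maxℕ xs ∈ xs
maxℕ-attained []       = inj₁ refl
maxℕ-attained (x ∷ xs) with ℕ.⊔-sel x (maxℕ xs) | maxℕ-attained xs
... | inj₁ max≡x | _            = inj₂ (here max≡x)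
... | inj₂ max≡m | inj₁ m≡0     = inj₁ (trans max≡m m≡0)
... | inj₂ max≡m | inj₂ m∈xs    = inj₂ (there (subst (_∈ xs) (sym max≡m) m∈xs))

-- Möbius functions of finite posets

module FinitePosetTheory (P : FinitePoset) (isPartialOrder : IsPartialOrder _≡_ (FinitePoset._≼_ P)) where

  open FinitePoset P public
  open FP P public
  open IsPartialOrder isPartialOrder using () renaming (refl to ≼-refl; trans to ≼-trans; antisym to ≼-antisym)

  _≺_ : Carrier → Carrier → Set
  x ≺ y = x ≼ y × ¬ x ≡ y

  ≺-irrefl : ∀ {x} → ¬ x ≺ x
  ≺-irrefl (_ , x≢x) = x≢x refl

  ≼-≺-trans : ∀ {x y z} → x ≼ y → y ≺ z → x ≺ z
  ≼-≺-trans x≼y (y≼z , y≢z) = ≼-trans x≼y y≼z , λ { refl → y≢z (≼-antisym y≼z x≼y) }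

  ≺-trans : ∀ {x y z} → x ≺ y → y ≺ z → x ≺ z
  ≺-trans (x≼y , _) = ≼-≺-trans x≼y

  interval : Carrier → Carrier → List Carrier
  interval x y = filter (λ z → (x ≼? z) ×-dec (z ≺? y)) elements

  interval⁻ : ∀ {x y z} → z ∈ interval x y → z ∈ elements × x ≼ z × z ≺ y
  interval⁻ {x} {y} z∈ with ∈-filter⁻ (λ z → (x ≼? z) ×-dec (z ≺? y)) z∈
  ... | z∈elements , x≼z , z≺y = z∈elements , x≼z , z≺y

  interval⁺ : ∀ {x y z} → z ∈ elements → x ≼ z → z ≺ y → z ∈ interval x y
  interval⁺ {x} {y} z∈elements x≼z z≺y = ∈-filter⁺ (λ z → (x ≼? z) ×-dec (z ≺? y)) z∈elements (x≼z , z≺y)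

  length-interval-< : ∀ {x y z} → z ∈ interval x y → length (interval x z) < length (interval x y)
  length-interval-< {x} {y} {z} z∈ with interval⁻ z∈
  ... | z∈elements , x≼z , z≺y =
    length-filter-strictMono (λ w → (x ≼? w) ×-dec (w ≺? z)) (λ w → (x ≼? w) ×-dec (w ≺? y))
      elements (λ (x≼w , w≺z) → x≼w , ≺-trans w≺z z≺y) z∈elements (x≼z , z≺y) (≺-irrefl ∘ proj₂)

  length-interval<fuel : ∀ x {y} → y ∈ elements → length (interval x y) < fuel
  length-interval<fuel x {y} y∈ = length-filter-< (λ w → (x ≼? w) ×-dec (w ≺? y)) elements y∈ (≺-irrefl ∘ proj₂)

  μ′-fuel-irrelevant : ∀ k k′ x y → length (interval x y) < k → length (interval x y) < k′ →
                       μ′ k x y ≡ μ′ k′ x y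
  μ′-fuel-irrelevant (suc k) (suc k′) x y <k <k′ with x ≟ y
  ... | yes _ = refl
  ... | no  _ with x ≼? y
  ...   | no  _ = refl
  ...   | yes _ = cong -_ (∑-cong (interval x y) (λ z∈ →
            μ′-fuel-irrelevant k k′ x _ (ℕ.<-≤-trans (length-interval-< z∈) (ℕ.≤-pred <k))
                                        (ℕ.<-≤-trans (length-interval-< z∈) (ℕ.≤-pred <k′))))

  μ′≡μ : ∀ {x y} → y ∈ elements → ∀ k → length (interval x y) < k → μ′ k x y ≡ μ x y
  μ′≡μ {x} {y} y∈ k <k = μ′-fuel-irrelevant k fuel x y <k (length-interval<fuel x y∈)

  μ-refl : ∀ {x} → x ∈ elements → μ x x ≡ 1ℤ
  μ-refl {x} x∈ = trans (sym (μ′≡μ x∈ (suc (length (interval x x))) ℕ.≤-refl)) μ′-refl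
    where
    μ′-refl : ∀ {k} → μ′ (suc k) x x ≡ 1ℤ
    μ′-refl with x ≟ x
    ... | yes _   = refl
    ... | no  x≢x = ⊥-elim (x≢x refl)

  μ-unfold : ∀ {x y} → y ∈ elements → x ≺ y → μ x y ≡ - ∑ (interval x y) (μ x)
  μ-unfold {x} {y} y∈ (x≼y , x≢y) = begin
    μ x y                                ≡⟨ sym (μ′≡μ y∈ (suc n) ℕ.≤-refl) ⟩
    μ′ (suc n) x y                       ≡⟨ unfold ⟩
    - ∑ (interval x y) (μ′ n x)          ≡⟨ cong -_ (∑-cong (interval x y) (λ z∈ →
                                              μ′≡μ (proj₁ (interval⁻ z∈)) n (length-interval-< z∈))) ⟩
    - ∑ (interval x y) (μ x)             ∎
    where
    n = length (interval x y)
    unfold : μ′ (suc n) x y ≡ - ∑ (interval x y) (μ′ n x)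
    unfold with x ≟ y
    ... | yes x≡y = ⊥-elim (x≢y x≡y)
    ... | no  _ with x ≼? y
    ...   | yes _   = refl
    ...   | no  x⋠y = ⊥-elim (x⋠y x≼y)

  module _ (elements-unique : Unique elements) where

    private
      closedSum openSum : Carrier → Carrier → ℤ
      closedSum x y = ∑ elements (λ z → when (x ≼? z) (when (z ≼? y) (μ z y)))
      openSum   x y = ∑ elements (λ z → when (x ≼? z) (when (z ≺? y) (μ z y)))

      closedSum≡1+openSum : ∀ {x y} → y ∈ elements → x ≼ y → closedSum x y ≡ 1ℤ +ℤ openSum x y
      closedSum≡1+openSum {x} {y} y∈ x≼y = begin
        closedSum x y                                                    ≡⟨ ∑-cong elements (λ _ → summand _) ⟩
        ∑ elements (λ z → when (z ≟ y) 1ℤ +ℤ when (x ≼? z) (when (z ≺? y) (μ z y)))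
                                                                         ≡⟨ ∑-+ elements _ _ ⟩
        ∑ elements (λ z → when (z ≟ y) 1ℤ) +ℤ openSum x y                ≡⟨ cong (_+ℤ openSum x y) δ-sum ⟩
        1ℤ +ℤ openSum x y                                                ∎
        where
        δ-sum : ∑ elements (λ z → when (z ≟ y) 1ℤ) ≡ 1ℤ
        δ-sum = trans (∑-single elements-unique y∈ (λ {z} _ z≢y → when-no (z ≟ y) z≢y 1ℤ)) (when-yes (y ≟ y) refl 1ℤ)
        summand : ∀ z → when (x ≼? z) (when (z ≼? y) (μ z y))
                          ≡ when (z ≟ y) 1ℤ +ℤ when (x ≼? z) (when (z ≺? y) (μ z y))
        summand z with toSum (z ≟ y)
        ... | inj₁ refl = begin
          when (x ≼? z) (when (z ≼? z) (μ z z))                      ≡⟨ when-yes (x ≼? z) x≼y _ ⟩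
          when (z ≼? z) (μ z z)                                      ≡⟨ when-yes (z ≼? z) ≼-refl _ ⟩
          μ z z                                                      ≡⟨ μ-refl y∈ ⟩
          1ℤ +ℤ 0ℤ                                                   ≡⟨ sym (cong₂ _+ℤ_ (when-yes (z ≟ z) refl 1ℤ)
                                                                          (when-when-disjoint (x ≼? z) (z ≺? z) (λ _ → ≺-irrefl) _)) ⟩
          when (z ≟ z) 1ℤ +ℤ when (x ≼? z) (when (z ≺? z) (μ z z))   ∎
        ... | inj₂ z≢y = begin
          when (x ≼? z) (when (z ≼? y) (μ z y))
            ≡⟨ cong (when (x ≼? z)) (when-⇔ (z ≼? y) (z ≺? y) (_, z≢y) proj₁ _) ⟩
          when (x ≼? z) (when (z ≺? y) (μ z y))
            ≡⟨ sym (ℤ.+-identityˡ _) ⟩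
          0ℤ +ℤ when (x ≼? z) (when (z ≺? y) (μ z y))
            ≡⟨ cong (_+ℤ when (x ≼? z) (when (z ≺? y) (μ z y))) (sym (when-no (z ≟ y) z≢y 1ℤ)) ⟩
          when (z ≟ y) 1ℤ +ℤ when (x ≼? z) (when (z ≺? y) (μ z y))   ∎

      openSum-expand : ∀ {x y} → y ∈ elements →
                       openSum x y ≡ - ∑ elements (λ w → when (x ≼? w) (when (w ≺? y) (closedSum x w)))
      openSum-expand {x} {y} y∈ = begin
        openSum x y
          ≡⟨ ∑-cong elements (λ {z} _ → when-cong (x ≼? z) (λ _ → when-cong (z ≺? y) (λ z≺y → expand z z≺y))) ⟩
        ∑ elements (λ z → when (x ≼? z) (when (z ≺? y) (- ∑ elements (λ w → when (z ≼? w) (when (w ≺? y) (μ z w))))))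
          ≡⟨ ∑-cong elements (λ {z} _ → pull-out z) ⟩
        ∑ elements (λ z → - ∑ elements (λ w → when⁴ (x ≼? z) (z ≺? y) (z ≼? w) (w ≺? y) (μ z w)))
          ≡⟨ sym (∑-neg elements _) ⟩
        - ∑ elements (λ z → ∑ elements (λ w → when⁴ (x ≼? z) (z ≺? y) (z ≼? w) (w ≺? y) (μ z w)))
          ≡⟨ cong -_ (∑-swap elements elements _) ⟩
        - ∑ elements (λ w → ∑ elements (λ z → when⁴ (x ≼? z) (z ≺? y) (z ≼? w) (w ≺? y) (μ z w)))
          ≡⟨ cong -_ (∑-cong elements (λ {w} _ → ∑-cong elements (λ {z} _ →
               when⁴-⇔ (x ≼? z) (z ≺? y) (z ≼? w) (w ≺? y) (x ≼? w) (w ≺? y) (x ≼? z) (z ≼? w)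
                 (λ (x≼z , _ , z≼w , w≺y) → ≼-trans x≼z z≼w , w≺y , x≼z , z≼w)
                 (λ (_ , w≺y , x≼z , z≼w) → x≼z , ≼-≺-trans z≼w w≺y , z≼w , w≺y) (μ z w)))) ⟩
        - ∑ elements (λ w → ∑ elements (λ z → when⁴ (x ≼? w) (w ≺? y) (x ≼? z) (z ≼? w) (μ z w)))
          ≡⟨ cong -_ (∑-cong elements (λ {w} _ → sym (push-in w))) ⟩
        - ∑ elements (λ w → when (x ≼? w) (when (w ≺? y) (closedSum x w)))
          ∎
        where
        expand : ∀ z → z ≺ y → μ z y ≡ - ∑ elements (λ w → when (z ≼? w) (when (w ≺? y) (μ z w)))
        expand z z≺y = trans (μ-unfold y∈ z≺y) (cong -_
          (trans (∑-filter (λ w → (z ≼? w) ×-dec (w ≺? y)) elements (μ z))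
                 (∑-cong elements (λ {w} _ → when-× (z ≼? w) (w ≺? y) _))))
        pull-out : ∀ z → when (x ≼? z) (when (z ≺? y) (- ∑ elements (λ w → when (z ≼? w) (when (w ≺? y) (μ z w)))))
                           ≡ - ∑ elements (λ w → when⁴ (x ≼? z) (z ≺? y) (z ≼? w) (w ≺? y) (μ z w))
        pull-out z = trans (cong (when (x ≼? z)) (trans (when-neg (z ≺? y) _) (cong -_ (when-∑ (z ≺? y) elements _))))
                           (trans (when-neg (x ≼? z) _) (cong -_ (when-∑ (x ≼? z) elements _)))
        push-in : ∀ w → when (x ≼? w) (when (w ≺? y) (closedSum x w))
                          ≡ ∑ elements (λ z → when⁴ (x ≼? w) (w ≺? y) (x ≼? z) (z ≼? w) (μ z w))
        push-in w = trans (cong (when (x ≼? w)) (when-∑ (w ≺? y) elements _)) (when-∑ (x ≼? w) elements _)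

      closedSum≡δ : ∀ n {x y} → x ∈ elements → y ∈ elements → length (interval x y) < n →
                    closedSum x y ≡ when (x ≟ y) 1ℤ
      closedSum≡δ (suc n) {x} {y} x∈ y∈ <n with x ≟ y | x ≼? y
      ... | yes refl | _ = trans (closedSum≡1+openSum y∈ ≼-refl)
                                 (cong (1ℤ +ℤ_) (∑-zero elements (λ {z} _ →
                                   when-when-disjoint (x ≼? z) (z ≺? x) (λ x≼z z≺x → ≺-irrefl (≼-≺-trans x≼z z≺x)) _)))
      ... | no _ | no x⋠y = ∑-zero elements (λ {z} _ →
                              when-when-disjoint (x ≼? z) (z ≼? y) (λ x≼z z≼y → x⋠y (≼-trans x≼z z≼y)) _)
      ... | no x≢y | yes x≼y = begin
        closedSum x y
          ≡⟨ closedSum≡1+openSum y∈ x≼y ⟩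
        1ℤ +ℤ openSum x y
          ≡⟨ cong (1ℤ +ℤ_) (openSum-expand y∈) ⟩
        1ℤ +ℤ - ∑ elements (λ w → when (x ≼? w) (when (w ≺? y) (closedSum x w)))
          ≡⟨ cong (λ s → 1ℤ +ℤ - s) inductive-step ⟩
        1ℤ +ℤ - ∑ elements (λ w → when (x ≼? w) (when (w ≺? y) (when (x ≟ w) 1ℤ)))
          ≡⟨ cong (λ s → 1ℤ +ℤ - s) δ-sum ⟩
        0ℤ ∎
        where
        inductive-step : ∑ elements (λ w → when (x ≼? w) (when (w ≺? y) (closedSum x w)))
                       ≡ ∑ elements (λ w → when (x ≼? w) (when (w ≺? y) (when (x ≟ w) 1ℤ)))
        inductive-step = ∑-cong elements (λ {w} w∈ → when-cong (x ≼? w) (λ x≼w → when-cong (w ≺? y) (λ w≺y →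
          closedSum≡δ n x∈ w∈ (ℕ.<-≤-trans (length-interval-< (interval⁺ w∈ x≼w w≺y)) (ℕ.≤-pred <n)))))
        δ-sum : ∑ elements (λ w → when (x ≼? w) (when (w ≺? y) (when (x ≟ w) 1ℤ))) ≡ 1ℤ
        δ-sum = begin
          ∑ elements (λ w → when (x ≼? w) (when (w ≺? y) (when (x ≟ w) 1ℤ)))
            ≡⟨ ∑-single elements-unique x∈ (λ {w} _ w≢x →
                 trans (cong (when (x ≼? w) ∘ when (w ≺? y)) (when-no (x ≟ w) (w≢x ∘ sym) 1ℤ))
                       (trans (cong (when (x ≼? w)) (when-0 (w ≺? y))) (when-0 (x ≼? w)))) ⟩
          when (x ≼? x) (when (x ≺? y) (when (x ≟ x) 1ℤ))
            ≡⟨ trans (when-yes (x ≼? x) ≼-refl _) (trans (when-yes (x ≺? y) (x≼y , x≢y) _) (when-yes (x ≟ x) refl 1ℤ)) ⟩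
          1ℤ ∎

    -- The definition of μ x y sums over the second argument; this identity sums over the first.
    μ-dual-recursion : ∀ {x y} → x ∈ elements → y ∈ elements →
                       ∑ elements (λ z → when (x ≼? z) (when (z ≼? y) (μ z y))) ≡ when (x ≟ y) 1ℤ
    μ-dual-recursion {x} {y} x∈ y∈ = closedSum≡δ (suc (length (interval x y))) x∈ y∈ ℕ.≤-refl

  module RankFunction (r : Carrier → ℕ)
    (r-strictMono : ∀ {y z} → y ∈ elements → z ∈ elements → z ≺ y → r z < r y)
    (r-lowerCover : ∀ {y} → y ∈ elements → r y ≡ 0 ⊎ ∃ λ z → z ∈ elements × z ≺ y × suc (r z) ≡ r y) where

    private
      below : Carrier → List Carrier
      below y = filter (_≺? y) elements

      length-below-< : ∀ {y z} → z ∈ elements → z ≺ y → length (below z) < length (below y)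
      length-below-< {y} {z} z∈ z≺y =
        length-filter-strictMono (_≺? z) (_≺? y) elements (λ w≺z → ≺-trans w≺z z≺y) z∈ z≺y ≺-irrefl

      r≤length-below : ∀ n {y} → y ∈ elements → r y ≡ n → n ≤ length (below y)
      r≤length-below zero    _  _    = z≤n
      r≤length-below (suc n) y∈ ry≡n with r-lowerCover y∈
      ... | inj₁ ry≡0 = ⊥-elim (ℕ.1+n≢0 (trans (sym ry≡n) ry≡0))
      ... | inj₂ (z , z∈ , z≺y , rz+1≡ry) =
        ℕ.≤-<-trans (r≤length-below n z∈ (ℕ.suc-injective (trans rz+1≡ry ry≡n))) (length-below-< z∈ z≺y)

      height′≡r : ∀ k {y} → y ∈ elements → r y < k → height′ k y ≡ r y
      height′≡r (suc k) {y} y∈ ry<k = begin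
        maxℕ (map (λ z → suc (height′ k z)) (below y))
          ≡⟨ cong maxℕ (List.map-cong-local (All.tabulate (λ z∈ → cong suc (IH z∈)))) ⟩
        maxℕ (map (λ z → suc (r z)) (below y))
          ≡⟨ ℕ.≤-antisym (maxℕ-least (map (λ z → suc (r z)) (below y)) upper) lower ⟩
        r y ∎
        where
        IH : ∀ {z} → z ∈ below y → height′ k z ≡ r z
        IH z∈ with ∈-filter⁻ (_≺? y) z∈
        ... | z∈elements , z≺y = height′≡r k z∈elements (ℕ.<-≤-trans (r-strictMono y∈ z∈elements z≺y) (ℕ.≤-pred ry<k))
        upper : ∀ {n} → n ∈ map (λ z → suc (r z)) (below y) → n ≤ r y
        upper n∈ with ∈-map⁻ (λ z → suc (r z)) n∈
        ... | z , z∈ , refl with ∈-filter⁻ (_≺? y) z∈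
        ...   | z∈elements , z≺y = r-strictMono y∈ z∈elements z≺y
        lower : r y ≤ maxℕ (map (λ z → suc (r z)) (below y))
        lower with r-lowerCover y∈
        ... | inj₁ ry≡0 = ℕ.≤-trans (ℕ.≤-reflexive ry≡0) z≤n
        ... | inj₂ (z , z∈ , z≺y , rz+1≡ry) = ℕ.≤-trans (ℕ.≤-reflexive (sym rz+1≡ry))
                (maxℕ-upper (∈-map⁺ (λ z → suc (r z)) (∈-filter⁺ (_≺? y) z∈ z≺y)))

    rank≡r : ∀ {y} → y ∈ elements → rank y ≡ r y
    rank≡r y∈ = height′≡r fuel y∈ (ℕ.≤-<-trans (r≤length-below _ y∈ refl)
                                               (length-filter-< (_≺? _) elements y∈ ≺-irrefl))

    rankP≡max-r : rankP ≡ maxℕ (map r elements)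
    rankP≡max-r = cong maxℕ (List.map-cong-local (All.tabulate rank≡r))

module OrderEmbedding (P Q : FinitePoset)
  (P-isPartialOrder : IsPartialOrder _≡_ (FinitePoset._≼_ P))
  (Q-isPartialOrder : IsPartialOrder _≡_ (FinitePoset._≼_ Q))
  (α : FinitePoset.Carrier P → FinitePoset.Carrier Q)
  (α-injective : ∀ {x y} → α x ≡ α y → x ≡ y)
  (α-mono : ∀ {x y} → FinitePoset._≼_ P x y → FinitePoset._≼_ Q (α x) (α y))
  (α-reflects : ∀ {x y} → FinitePoset._≼_ Q (α x) (α y) → FinitePoset._≼_ P x y) where

  module P = FinitePosetTheory P P-isPartialOrder
  module Q = FinitePosetTheory Q Q-isPartialOrder

  module _ (x : P.Carrier) {ℓ} (Good : Pred P.Carrier ℓ)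
    (interval-image : ∀ {z} → Good z → Q.interval (α x) (α z) ↭ map α (P.interval x z))
    (interval-Good : ∀ {z w} → Good z → w ∈ P.interval x z → Good w) where

    μ′-image : ∀ k {z} → Good z → Q.μ′ k (α x) (α z) ≡ P.μ′ k x z
    μ′-image zero    _ = refl
    μ′-image (suc k) {z} z-good with x P.≟ z | α x Q.≟ α z
    ... | yes _   | yes _    = refl
    ... | yes x≡z | no αx≢αz = ⊥-elim (αx≢αz (cong α x≡z))
    ... | no x≢z  | yes αx≡αz = ⊥-elim (x≢z (α-injective αx≡αz))
    ... | no _    | no _ with x P.≼? z | α x Q.≼? α z
    ...   | yes _   | yes _     = cong -_ (begin
              ∑ (Q.interval (α x) (α z)) (Q.μ′ k (α x))     ≡⟨ ∑-↭ _ (interval-image z-good) ⟩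
              ∑ (map α (P.interval x z)) (Q.μ′ k (α x))     ≡⟨ ∑-map (P.interval x z) α _ ⟩
              ∑ (P.interval x z) (Q.μ′ k (α x) ∘ α)
                ≡⟨ ∑-cong (P.interval x z) (μ′-image k ∘ interval-Good z-good) ⟩
              ∑ (P.interval x z) (P.μ′ k x)                 ∎)
    ...   | yes x≼z | no αx⋠αz  = ⊥-elim (αx⋠αz (α-mono x≼z))
    ...   | no x⋠z  | yes αx≼αz = ⊥-elim (x⋠z (α-reflects αx≼αz))
    ...   | no _    | no _      = refl

    μ-image : ∀ {z} → Good z → z ∈ P.elements → α z ∈ Q.elements → Q.μ (α x) (α z) ≡ P.μ x z
    μ-image {z} z-good z∈ αz∈ = begin
      Q.μ (α x) (α z)      ≡⟨ sym (Q.μ′≡μ αz∈ (suc n) (ℕ.≤-reflexive (cong suc same-length))) ⟩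
      Q.μ′ (suc n) (α x) (α z) ≡⟨ μ′-image (suc n) z-good ⟩
      P.μ′ (suc n) x z     ≡⟨ P.μ′≡μ z∈ (suc n) ℕ.≤-refl ⟩
      P.μ x z              ∎
      where
      n = length (P.interval x z)
      same-length : length (Q.interval (α x) (α z)) ≡ n
      same-length = trans (↭-length (interval-image z-good)) (List.length-map α (P.interval x z))

restrict : (P : FinitePoset) {q : Level} {Q : Pred (FinitePoset.Carrier P) q} → Decidable Q → FinitePoset
restrict P Q? = record P { elements = filter Q? (FinitePoset.elements P) }

module Restriction (P : FinitePoset) (isPartialOrder : IsPartialOrder _≡_ (FinitePoset._≼_ P))
  {q} {Q : Pred (FinitePoset.Carrier P) q} (Q? : Decidable Q) where

  module P = FinitePosetTheory P isPartialOrder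
  module R = FinitePosetTheory (restrict P Q?) isPartialOrder

  module _ {x} (Q-upper : ∀ {z} → x P.≼ z → Q z) where

    interval-restrict : ∀ y → R.interval x y ≡ P.interval x y
    interval-restrict y = trans (filter-filter (λ z → (x P.≼? z) ×-dec (z P.≺? y)) Q? P.elements)
                                (List.filter-≐ _ _ (proj₂ , λ in-interval → Q-upper (proj₁ in-interval) , in-interval) P.elements)

    μ′-restrict : ∀ k y → R.μ′ k x y ≡ P.μ′ k x y
    μ′-restrict zero    y = refl
    μ′-restrict (suc k) y with x P.≟ y
    ... | yes _ = refl
    ... | no  _ with x P.≼? y
    ...   | no  _ = refl
    ...   | yes _ = cong -_ (trans (cong (λ l → ∑ l (R.μ′ k x)) (interval-restrict y))
                                   (∑-cong (P.interval x y) (λ _ → μ′-restrict k _)))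

    μ-restrict : ∀ {y} → y ∈ R.elements → R.μ x y ≡ P.μ x y
    μ-restrict {y} y∈ = begin
      R.μ x y                  ≡⟨ sym (R.μ′≡μ y∈ (suc n) (ℕ.≤-reflexive (cong (suc ∘ length) (interval-restrict y)))) ⟩
      R.μ′ (suc n) x y         ≡⟨ μ′-restrict (suc n) y ⟩
      P.μ′ (suc n) x y         ≡⟨ P.μ′≡μ (proj₁ (∈-filter⁻ Q? y∈)) (suc n) ℕ.≤-refl ⟩
      P.μ x y                  ∎
      where n = length (P.interval x y)

-- Ranked meet semilattices and geometric semilattices

module RankedMeetSemilatticeProperties {m : ℕ} (M : RankedMeetSemilattice m) where

  open RankedMeetSemilattice M public
  open IsMeetSemilattice isMeetSemilattice public using (isPartialOrder; x∧y≤x; x∧y≤y; ∧-greatest)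
    renaming (refl to ≤-refl; trans to ≤-trans; antisym to ≤-antisym)

  _<M_ : Fin m → Fin m → Set
  x <M y = x ≤M y × ¬ x ≡ y

  between : Fin m → Fin m → List (Fin m)
  between x y = filter (λ v → ((x ≤M? v) ×-dec ¬? (x ≟Fin v)) ×-dec (v ≤M? y)) (allFin m)

  length-between-<ˡ : ∀ {x z y} → x <M z → z ≤M y → length (between z y) < length (between x y)
  length-between-<ˡ {x} {z} {y} (x≤z , x≢z) z≤y =
    length-filter-strictMono (λ v → ((z ≤M? v) ×-dec ¬? (z ≟Fin v)) ×-dec (v ≤M? y))
                             (λ v → ((x ≤M? v) ×-dec ¬? (x ≟Fin v)) ×-dec (v ≤M? y)) (allFin m)
      (λ ((z≤v , z≢v) , v≤y) → (≤-trans x≤z z≤v , λ { refl → z≢v (≤-antisym z≤v x≤z) }) , v≤y)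
      (∈-allFin z) ((x≤z , x≢z) , z≤y) (λ ((_ , z≢z) , _) → z≢z refl)

  length-between-<ʳ : ∀ {x w y} → x <M y → w <M y → length (between x w) < length (between x y)
  length-between-<ʳ {x} {w} {y} x<y (w≤y , w≢y) =
    length-filter-strictMono (λ v → ((x ≤M? v) ×-dec ¬? (x ≟Fin v)) ×-dec (v ≤M? w))
                             (λ v → ((x ≤M? v) ×-dec ¬? (x ≟Fin v)) ×-dec (v ≤M? y)) (allFin m)
      (λ (x<v , v≤w) → x<v , ≤-trans v≤w w≤y)
      (∈-allFin y) (x<y , ≤-refl) (λ (_ , y≤w) → w≢y (≤-antisym w≤y y≤w))

  strictly-between : ∀ {x y} → x <M y → ¬ x ⋖ y → ∃ λ w → x <M w × w <M y
  strictly-between {x} {y} (x≤y , x≢y) x⋖̸y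
    with ¬∀⟶∃¬ m _ (λ z → (x ≤M? z) →-dec ((z ≤M? y) →-dec ((z ≟Fin x) ⊎-dec (z ≟Fin y))))
                   (λ no-between → x⋖̸y (x≤y , x≢y , λ z → no-between z))
  ... | w , w-between with x ≤M? w | w ≤M? y | w ≟Fin x | w ≟Fin y
  ... | yes x≤w | yes w≤y | no w≢x | no w≢y = w , (x≤w , w≢x ∘ sym) , (w≤y , w≢y)
  ... | no x≰w  | _       | _      | _      = ⊥-elim (w-between (⊥-elim ∘ x≰w))
  ... | yes _   | no w≰y  | _      | _      = ⊥-elim (w-between (λ _ → ⊥-elim ∘ w≰y))
  ... | yes _   | yes _   | yes w≡x | _     = ⊥-elim (w-between (λ _ _ → inj₁ w≡x))
  ... | yes _   | yes _   | no _   | yes w≡y = ⊥-elim (w-between (λ _ _ → inj₂ w≡y))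

  private
    lowerCover′ : ∀ n {x y} → length (between x y) < n → x <M y → ∃ λ z → x ≤M z × z ⋖ y
    lowerCover′ (suc n) {x} {y} <n x<y with x ⋖? y
    ... | yes x⋖y = x , ≤-refl , x⋖y
    ... | no  x⋖̸y with strictly-between x<y x⋖̸y
    ...   | w , x<w , w<y with lowerCover′ n (ℕ.<-≤-trans (length-between-<ˡ x<w (proj₁ w<y)) (ℕ.≤-pred <n)) w<y
    ...     | z , w≤z , z⋖y = z , ≤-trans (proj₁ x<w) w≤z , z⋖y

  lowerCover : ∀ {x y} → x <M y → ∃ λ z → x ≤M z × z ⋖ y
  lowerCover {x} {y} = lowerCover′ (suc (length (between x y))) ℕ.≤-refl

  private
    rk-strictMono′ : ∀ n {x y} → length (between x y) < n → x <M y → rk x < rk y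
    rk-strictMono′ (suc n) {x} {y} <n x<y with lowerCover x<y
    ... | z , x≤z , z⋖y with x ≟Fin z
    ...   | yes refl = ℕ.≤-reflexive (sym (rk-⋖ z⋖y))
    ...   | no  x≢z  = ℕ.<-trans (rk-strictMono′ n (ℕ.<-≤-trans (length-between-<ʳ x<y z<y) (ℕ.≤-pred <n)) (x≤z , x≢z))
                                 (ℕ.≤-reflexive (sym (rk-⋖ z⋖y)))
      where z<y = proj₁ z⋖y , proj₁ (proj₂ z⋖y)

  rk-strictMono : ∀ {x y} → x <M y → rk x < rk y
  rk-strictMono {x} {y} = rk-strictMono′ (suc (length (between x y))) ℕ.≤-refl

  rk≡0⇒≡⊥ : ∀ {x} → rk x ≡ 0 → x ≡ ⊥M
  rk≡0⇒≡⊥ {x} rkx≡0 with x ≟Fin ⊥M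
  ... | yes x≡⊥ = x≡⊥
  ... | no  x≢⊥ = ⊥-elim (ℕ.<⇒≢ (rk-strictMono (⊥M-min x , x≢⊥ ∘ sym)) (trans rk-⊥ (sym rkx≡0)))

  rk-atom : ∀ {a} → IsAtom a → rk a ≡ 1
  rk-atom ⊥⋖a = trans (rk-⋖ ⊥⋖a) (cong suc rk-⊥)

  below-atom : ∀ {a x} → IsAtom a → x ≤M a → x ≡ ⊥M ⊎ x ≡ a
  below-atom {a} {x} (_ , _ , nothing-between) x≤a = nothing-between x (⊥M-min x) x≤a

∣p∪⁅x⁆∣≡1+∣p∣ : ∀ {n} (p : Subset n) {x} → ¬ x ∈ˢ p → ∣ p ∪ ⁅ x ⁆ ∣ ≡ suc ∣ p ∣
∣p∪⁅x⁆∣≡1+∣p∣ (outside ∷ p) {zero}  _   = cong (suc ∘ ∣_∣) (∪-identityʳ p)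
∣p∪⁅x⁆∣≡1+∣p∣ (inside  ∷ p) {zero}  x∉p = ⊥-elim (x∉p Vec.here)
∣p∪⁅x⁆∣≡1+∣p∣ (outside ∷ p) {suc x} x∉p = ∣p∪⁅x⁆∣≡1+∣p∣ p (x∉p ∘ Vec.there)
∣p∪⁅x⁆∣≡1+∣p∣ (inside  ∷ p) {suc x} x∉p = cong suc (∣p∪⁅x⁆∣≡1+∣p∣ p (x∉p ∘ Vec.there))

x∈p∪⁅y⁆⁻ : ∀ {n} {p : Subset n} {x y} → x ∈ˢ p ∪ ⁅ y ⁆ → x ∈ˢ p ⊎ x ≡ y
x∈p∪⁅y⁆⁻ {p = p} {y = y} x∈ with x∈p∪q⁻ p ⁅ y ⁆ x∈
... | inj₁ x∈p    = inj₁ x∈p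
... | inj₂ x∈⁅y⁆ = inj₂ (x∈⁅y⁆⇒x≡y y x∈⁅y⁆)

module GeometricSemilatticeProperties {m : ℕ} (M : RankedMeetSemilattice m) (G : IsGeometricSemilattice M) where

  open RankedMeetSemilatticeProperties M public
  open IsGeometricSemilattice G public

  joinBelow⇒join : ∀ {v x y j} → IsJoinBelow v x y j → IsJoin x y j
  joinBelow⇒join {v} {x} {y} {j} (j≤v , x≤j , y≤j , least) =
    x≤j , y≤j , λ u x≤u y≤u →
      ≤-trans (least (j ∧M u) (≤-trans (x∧y≤x j u) j≤v) (∧-greatest x≤j x≤u) (∧-greatest y≤j y≤u)) (x∧y≤y j u)

  join-of-bounded : ∀ {x y v} → x ≤M v → y ≤M v → ∃ (IsJoin x y)
  join-of-bounded {v = v} x≤v y≤v with proj₁ (ideals v) _ _ x≤v y≤v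
  ... | j , j-joinBelow = j , joinBelow⇒join j-joinBelow

  -- Semimodularity in the ideal below t ∨ a, where t ∧ a = 0̂.
  rk-join-atom : ∀ {a t v} → IsAtom a → ¬ a ≤M t → IsJoin t a v → rk v ≡ suc (rk t)
  rk-join-atom {a} {t} {v} atom-a a≰t (t≤v , a≤v , least) = ℕ.≤-antisym upper (rk-strictMono (t≤v , λ { refl → a≰t a≤v }))
    where
    semimodular : rk (t ∧M a) + rk v ≤ rk t + rk a
    semimodular = proj₁ (proj₂ (ideals v)) t a v t≤v a≤v (≤-refl , t≤v , a≤v , λ u _ → least u)
    rk-meet : rk (t ∧M a) ≡ 0
    rk-meet with below-atom atom-a (x∧y≤y t a)
    ... | inj₁ t∧a≡⊥ = trans (cong rk t∧a≡⊥) rk-⊥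
    ... | inj₂ t∧a≡a = ⊥-elim (a≰t (subst (_≤M t) t∧a≡a (x∧y≤x t a)))
    upper : rk v ≤ suc (rk t)
    upper = subst₂ _≤_ (cong (_+ rk v) rk-meet) (trans (cong (rk t +_) (rk-atom atom-a)) (ℕ.+-comm (rk t) 1)) semimodular

  Independent : Subset m → Fin m → Set
  Independent = IndependentWithJoin M

  independent-atom : ∀ {S j b} → Independent S j → b ∈ˢ S → IsAtom b
  independent-atom (atoms , _ , _) b∈S = atoms _ b∈S

  independent-≤ : ∀ {S j b} → Independent S j → b ∈ˢ S → b ≤M j
  independent-≤ (_ , (upper , _) , _) b∈S = upper _ b∈S

  independent-least : ∀ {S j u} → Independent S j → (∀ b → b ∈ˢ S → b ≤M u) → j ≤M u
  independent-least (_ , (_ , least) , _) = least _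

  independent-insert : ∀ {S j a v} → Independent S j → IsAtom a → ¬ a ≤M j → IsJoin j a v →
                       Independent (S ∪ ⁅ a ⁆) v
  independent-insert {S} {j} {a} {v} S-indep atom-a a≰j j∨a@(j≤v , a≤v , least) =
    (λ b b∈ → atom (x∈p∪⁅y⁆⁻ b∈)) ,
    ((λ b b∈ → upper (x∈p∪⁅y⁆⁻ b∈)) ,
     (λ u ≤u → least u (independent-least S-indep (λ b b∈S → ≤u b (x∈p∪q⁺ (inj₁ b∈S))))
                       (≤u a (x∈p∪q⁺ (inj₂ (x∈⁅x⁆ a)))))) ,
    trans (rk-join-atom atom-a a≰j j∨a)
          (trans (cong suc (proj₂ (proj₂ S-indep))) (sym (∣p∪⁅x⁆∣≡1+∣p∣ S (a≰j ∘ independent-≤ S-indep))))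
    where
    atom : ∀ {b} → b ∈ˢ S ⊎ b ≡ a → IsAtom b
    atom (inj₁ b∈S) = independent-atom S-indep b∈S
    atom (inj₂ refl) = atom-a
    upper : ∀ {b} → b ∈ˢ S ⊎ b ≡ a → b ≤M v
    upper (inj₁ b∈S) = ≤-trans (independent-≤ S-indep b∈S) j≤v
    upper (inj₂ refl) = a≤v

  cover-join : ∀ {z s d} → z ⋖ s → d ≤M s → ¬ d ≤M z → IsJoin z d s
  cover-join {z} {s} {d} (z≤s , _ , z⋖s) d≤s d≰z =
    z≤s , d≤s , λ u z≤u d≤u → s≤u (z⋖s (s ∧M u) (∧-greatest z≤s z≤u) (x∧y≤x s u)) d≤u
    where
    s≤u : ∀ {u} → s ∧M u ≡ z ⊎ s ∧M u ≡ s → d ≤M u → s ≤M u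
    s≤u (inj₁ s∧u≡z) d≤u = ⊥-elim (d≰z (subst (d ≤M_) s∧u≡z (∧-greatest d≤s d≤u)))
    s≤u {u} (inj₂ s∧u≡s) _ = subst (_≤M u) s∧u≡s (x∧y≤y s u)

  atom-outside-cover : ∀ {z s} → z ⋖ s → ∃ λ d → IsAtom d × d ≤M s × ¬ d ≤M z
  atom-outside-cover {z} {s} (z≤s , z≢s , _) with proj₂ (proj₂ (ideals s)) s ≤-refl
  ... | T , atoms , _ , T≤s , T-least with any? (λ d → (d ∈? T) ×-dec ¬? (d ≤M? z))
  ...   | yes (d , d∈T , d≰z) = d , atoms d d∈T , T≤s d d∈T , d≰z
  ...   | no  none = ⊥-elim (z≢s (≤-antisym z≤s (T-least z z≤s T≤z)))
    where
    T≤z : ∀ d → d ∈ˢ T → d ≤M z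
    T≤z d d∈T with d ≤M? z
    ... | yes d≤z = d≤z
    ... | no  d≰z = ⊥-elim (none (d , d∈T , d≰z))

  private
    basis′ : ∀ n s → rk s ≡ n → ∃ λ S → Independent S s
    basis′ zero s rks≡0 with rk≡0⇒≡⊥ rks≡0
    ... | refl = ∅ , (λ _ → ⊥-elim ∘ ∉⊥) , ((λ _ → ⊥-elim ∘ ∉⊥) , (λ u _ → ⊥M-min u)) ,
                 trans rk-⊥ (sym (∣⊥∣≡0 m))
    basis′ (suc n) s rks≡1+n with lowerCover (⊥M-min s , λ { refl → ℕ.1+n≢0 (trans (sym rks≡1+n) rk-⊥) })
    ... | z , _ , z⋖s with basis′ n z (ℕ.suc-injective (trans (sym (rk-⋖ z⋖s)) rks≡1+n)) | atom-outside-cover z⋖s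
    ...   | S , S-indep | d , atom-d , d≤s , d≰z =
      S ∪ ⁅ d ⁆ , independent-insert S-indep atom-d d≰z (cover-join z⋖s d≤s d≰z)

  basis : ∀ s → ∃ λ S → Independent S s
  basis s = basis′ (rk s) s refl

  -- a ∈ A_u ∪ P_u: these are the atoms of A̲ u.
  InClosure : Fin m → Fin m → Set
  InClosure u a = a ≤M u ⊎ NoCommonUB a u

  inClosure? : ∀ u a → Dec (InClosure u a)
  inClosure? u a = (a ≤M? u) ⊎-dec noCommonUB? a u

  inClosure-mono : ∀ {s t a} → s ≤M t → InClosure s a → InClosure t a
  inClosure-mono s≤t (inj₁ a≤s)      = inj₁ (≤-trans a≤s s≤t)
  inClosure-mono s≤t (inj₂ no-bound) = inj₂ (λ (w , a≤w , t≤w) → no-bound (w , a≤w , ≤-trans s≤t t≤w))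

  ¬inClosure⇒join : ∀ {u a} → ¬ InClosure u a → ∃ (IsJoin u a)
  ¬inClosure⇒join {u} {a} a∉cl with any? (λ w → (a ≤M? w) ×-dec (u ≤M? w))
  ... | yes (w , a≤w , u≤w) = join-of-bounded u≤w a≤w
  ... | no  no-bound        = ⊥-elim (a∉cl (inj₂ (λ (w , a≤w , u≤w) → no-bound (w , a≤w , u≤w))))

  join⇒¬inClosure : ∀ {u a v} → ¬ a ≤M u → IsJoin u a v → ¬ InClosure u a
  join⇒¬inClosure a≰u _ (inj₁ a≤u) = a≰u a≤u
  join⇒¬inClosure _ (u≤v , a≤v , _) (inj₂ no-bound) = no-bound (_ , a≤v , u≤v)

  rk-closure-bound : ∀ {I t u} → Independent I t → (∀ {b} → b ∈ˢ I → InClosure u b) → rk t ≤ rk u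
  rk-closure-bound {I} {t} {u} I-indep I⊆cl-u with rk u <? rk t
  ... | no  rku≮rkt = ℕ.≮⇒≥ rku≮rkt
  ... | yes rku<rkt with augmented I t I-indep u rku<rkt
  ...   | b , b∈I , b≰u , _ , u∨b = ⊥-elim (join⇒¬inClosure b≰u u∨b (I⊆cl-u b∈I))

  -- If ¬ InClosure u a, then K ∪ {a} (K a basis of u) is independent of rank rk u + 1, so
  -- augmentation keeps enlarging J by elements of K (never by a, since InClosure s a). The
  -- enlarged sets stay within the closure of u, so rk-closure-bound caps their rank at rk u.
  closure-transitive : ∀ {J s u a} → Independent J s → (∀ {b} → b ∈ˢ J → InClosure u b) →
                       IsAtom a → InClosure s a → InClosure u a
  closure-transitive {J} {s} {u} {a} J-indep J⊆cl-u atom-a a∈cl-s with inClosure? u a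
  ... | yes a∈cl-u = a∈cl-u
  ... | no  a∉cl-u = ⊥-elim (grow (suc (rk u)) J-indep (λ b∈J → b∈J) inj₁ (ℕ.m≤n+m _ _))
    where
    w = proj₁ (¬inClosure⇒join a∉cl-u)
    u∨a = proj₂ (¬inClosure⇒join a∉cl-u)
    a≰u : ¬ a ≤M u
    a≰u = a∉cl-u ∘ inj₁
    K = proj₁ (basis u)
    K-indep = proj₂ (basis u)
    Ka-indep : Independent (K ∪ ⁅ a ⁆) w
    Ka-indep = independent-insert K-indep atom-a a≰u u∨a
    covered : ∀ {I} → (∀ {b} → b ∈ˢ I → b ∈ˢ J ⊎ b ∈ˢ K) → ∀ {b} → b ∈ˢ I → InClosure u b
    covered I⊆J∪K b∈I with I⊆J∪K b∈I
    ... | inj₁ b∈J = J⊆cl-u b∈J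
    ... | inj₂ b∈K = inj₁ (independent-≤ K-indep b∈K)
    grow : ∀ n {I t} → Independent I t → (∀ {b} → b ∈ˢ J → b ∈ˢ I) → (∀ {b} → b ∈ˢ I → b ∈ˢ J ⊎ b ∈ˢ K) →
           rk u < rk t + n → False
    grow n {I} {t} I-indep J⊆I I⊆J∪K rku<rkt+n
      with augmented (K ∪ ⁅ a ⁆) w Ka-indep t
             (subst (rk t <_) (sym (rk-join-atom atom-a a≰u u∨a)) (s≤s (rk-closure-bound I-indep (covered I⊆J∪K))))
    ... | b , b∈Ka , b≰t , v , t∨b with x∈p∪⁅y⁆⁻ b∈Ka | n
    ...   | inj₂ refl | _ = join⇒¬inClosure b≰t t∨b (inClosure-mono s≤t a∈cl-s)
      where s≤t = independent-least J-indep (λ _ b∈J → independent-≤ I-indep (J⊆I b∈J))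
    ...   | inj₁ b∈K | zero = ℕ.<-irrefl refl
      (ℕ.<-≤-trans (subst (rk u <_) (ℕ.+-identityʳ (rk t)) rku<rkt+n) (rk-closure-bound I-indep (covered I⊆J∪K)))
    ...   | inj₁ b∈K | suc n′ =
      grow n′ (independent-insert I-indep atom-b b≰t t∨b) (x∈p∪q⁺ ∘ inj₁ ∘ J⊆I) Ib⊆J∪K
           (subst (rk u <_) (trans (ℕ.+-suc (rk t) n′) (cong (_+ n′) (sym (rk-join-atom atom-b b≰t t∨b)))) rku<rkt+n)
      where
      atom-b = independent-atom K-indep b∈K
      Ib⊆J∪K : ∀ {c} → c ∈ˢ I ∪ ⁅ b ⁆ → c ∈ˢ J ⊎ c ∈ˢ K
      Ib⊆J∪K c∈ with x∈p∪⁅y⁆⁻ c∈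
      ... | inj₁ c∈I  = I⊆J∪K c∈I
      ... | inj₂ refl = inj₂ b∈K

-- The cone and the centralization

does≡true⇒ : ∀ {p} {P : Set p} (P? : Dec P) → does P? ≡ true → P
does≡true⇒ (yes p) _ = p

∈-tabulate⁻ : ∀ {n} {f : Fin n → Bool} {i} → i ∈ˢ Vec.tabulate f → f i ≡ true
∈-tabulate⁻ {f = f} {i} i∈ = trans (sym (Vec.lookup∘tabulate f i)) (Vec.[]=⇒lookup i∈)

∈-tabulate⁺ : ∀ {n} {f : Fin n → Bool} {i} → f i ≡ true → i ∈ˢ Vec.tabulate f
∈-tabulate⁺ {f = f} {i} fi≡true = Vec.lookup⇒[]= i _ (trans (Vec.lookup∘tabulate f i) fi≡true)

∈-allSubsets : ∀ {n} (p : Subset n) → p ∈ allSubsets n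
∈-allSubsets {zero}  []            = here refl
∈-allSubsets {suc n} (outside ∷ p) = ∈-++⁺ˡ (∈-map⁺ (outside ∷_) (∈-allSubsets p))
∈-allSubsets {suc n} (inside  ∷ p) = ∈-++⁺ʳ (map (outside ∷_) (allSubsets n)) (∈-map⁺ (inside ∷_) (∈-allSubsets p))

allSubsets-unique : ∀ n → Unique (allSubsets n)
allSubsets-unique zero    = [] ∷ []
allSubsets-unique (suc n) = Unique.++⁺ (Unique.map⁺ Vec.∷-injectiveʳ (allSubsets-unique n))
                                       (Unique.map⁺ Vec.∷-injectiveʳ (allSubsets-unique n)) disjoint
  where
  disjoint : ∀ {p} → p ∈ map (outside ∷_) (allSubsets n) × p ∈ map (inside ∷_) (allSubsets n) → False
  disjoint (p∈outside , p∈inside) with ∈-map⁻ (outside ∷_) p∈outside | ∈-map⁻ (inside ∷_) p∈inside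
  ... | _ , _ , refl | _ , _ , ()

module ConeProperties {m : ℕ} (M : RankedMeetSemilattice m) (G : IsGeometricSemilattice M) where

  open GeometricSemilatticeProperties M G public
  open Cone M public

  ∈A⁻ : ∀ {a s} → suc a ∈ˢ A s → IsAtom a × a ≤M s
  ∈A⁻ {a} {s} (Vec.there a∈) = does≡true⇒ (atom? a ×-dec (a ≤M? s)) (∈-tabulate⁻ a∈)

  ∈A⁺ : ∀ {a s} → IsAtom a → a ≤M s → suc a ∈ˢ A s
  ∈A⁺ {a} {s} atom-a a≤s = Vec.there (∈-tabulate⁺ (dec-true (atom? a ×-dec (a ≤M? s)) (atom-a , a≤s)))

  ∈A̲⁻ : ∀ {a s} → suc a ∈ˢ A̲ s → IsAtom a × InClosure s a
  ∈A̲⁻ {a} {s} (Vec.there a∈) = does≡true⇒ (atom? a ×-dec inClosure? s a) (∈-tabulate⁻ a∈)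

  ∈A̲⁺ : ∀ {a s} → IsAtom a → InClosure s a → suc a ∈ˢ A̲ s
  ∈A̲⁺ {a} {s} atom-a a∈cl = Vec.there (∈-tabulate⁺ (dec-true (atom? a ×-dec inClosure? s a) (atom-a , a∈cl)))

  ∈-basis⇒∈A : ∀ {S s a} → Independent S s → a ∈ˢ S → suc a ∈ˢ A s
  ∈-basis⇒∈A S-indep a∈S = ∈A⁺ (independent-atom S-indep a∈S) (independent-≤ S-indep a∈S)

  A-mono : ∀ {s t} → s ≤M t → A s ⊆ˢ A t
  A-mono s≤t {suc a} a∈As = let atom-a , a≤s = ∈A⁻ a∈As in ∈A⁺ atom-a (≤-trans a≤s s≤t)

  A-reflects : ∀ {s t} → A s ⊆ˢ A t → s ≤M t
  A-reflects {s} As⊆At = independent-least S-indep (λ _ a∈S → proj₂ (∈A⁻ (As⊆At (∈-basis⇒∈A S-indep a∈S))))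
    where S-indep = proj₂ (basis s)

  A-injective : ∀ {s t} → A s ≡ A t → s ≡ t
  A-injective As≡At = ≤-antisym (A-reflects (⊆-reflexive As≡At)) (A-reflects (⊆-reflexive (sym As≡At)))

  A⊥≡∅ : A ⊥M ≡ ∅
  A⊥≡∅ = ⊆-antisym A⊥⊆∅ ⊥⊆
    where
    A⊥⊆∅ : A ⊥M ⊆ˢ ∅
    A⊥⊆∅ {suc a} a∈A⊥ with ∈A⁻ a∈A⊥
    ... | (_ , a≢⊥ , _) , a≤⊥ = ⊥-elim (a≢⊥ (≤-antisym (⊥M-min a) a≤⊥))

  A̲-mono : ∀ {s t} → s ≤M t → A̲ s ⊆ˢ A̲ t
  A̲-mono s≤t {zero}  _ = Vec.here
  A̲-mono s≤t {suc a} a∈A̲s = let atom-a , a∈cl-s = ∈A̲⁻ a∈A̲s in ∈A̲⁺ atom-a (inClosure-mono s≤t a∈cl-s)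

  A⊆A̲ : ∀ {s} → A s ⊆ˢ A̲ s
  A⊆A̲ {s} {suc a} a∈As = ∈A̲⁺ (proj₁ (∈A⁻ a∈As)) (inj₁ (proj₂ (∈A⁻ a∈As)))

  independent⇒A̲⊆A̲ : ∀ {J s u} → Independent J s → (∀ {b} → b ∈ˢ J → suc b ∈ˢ A̲ u) → A̲ s ⊆ˢ A̲ u
  independent⇒A̲⊆A̲ J-indep J⊆A̲u {zero}  _ = Vec.here
  independent⇒A̲⊆A̲ J-indep J⊆A̲u {suc a} a∈A̲s with ∈A̲⁻ a∈A̲s
  ... | atom-a , a∈cl-s = ∈A̲⁺ atom-a (closure-transitive J-indep (proj₂ ∘ ∈A̲⁻ ∘ J⊆A̲u) atom-a a∈cl-s)

  A⊆A̲⇒A̲⊆A̲ : ∀ {s u} → A s ⊆ˢ A̲ u → A̲ s ⊆ˢ A̲ u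
  A⊆A̲⇒A̲⊆A̲ {s} As⊆A̲u = independent⇒A̲⊆A̲ S-indep (As⊆A̲u ∘ ∈-basis⇒∈A S-indep)
    where S-indep = proj₂ (basis s)

  A̲⊆A̲⇒rk≤ : ∀ {s u} → A̲ s ⊆ˢ A̲ u → rk s ≤ rk u
  A̲⊆A̲⇒rk≤ {s} A̲s⊆A̲u = rk-closure-bound S-indep (proj₂ ∘ ∈A̲⁻ ∘ A̲s⊆A̲u ∘ A⊆A̲ ∘ ∈-basis⇒∈A S-indep)
    where S-indep = proj₂ (basis s)

  A̲≡A̲⇒rk≡ : ∀ {s u} → A̲ s ≡ A̲ u → rk s ≡ rk u
  A̲≡A̲⇒rk≡ A̲s≡A̲u =
    ℕ.≤-antisym (A̲⊆A̲⇒rk≤ (⊆-reflexive A̲s≡A̲u)) (A̲⊆A̲⇒rk≤ (⊆-reflexive (sym A̲s≡A̲u)))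

  -- An atom b ∈ A_u outside A̲_s exists by the closure property; then s ∨ b is the step.
  A̲⊂A̲⇒step : ∀ {s u} → A̲ s ⊆ˢ A̲ u → ¬ A̲ s ≡ A̲ u →
              ∃ λ x → s ≤M x × rk x ≡ suc (rk s) × A̲ x ⊆ˢ A̲ u
  A̲⊂A̲⇒step {s} {u} A̲s⊆A̲u A̲s≢A̲u with any? (λ b → (suc b ∈? A u) ×-dec ¬? (suc b ∈? A̲ s))
  ... | no  none = ⊥-elim (A̲s≢A̲u (⊆-antisym A̲s⊆A̲u (A⊆A̲⇒A̲⊆A̲ Au⊆A̲s)))
    where
    Au⊆A̲s : A u ⊆ˢ A̲ s
    Au⊆A̲s {suc b} b∈Au with suc b ∈? A̲ s
    ... | yes b∈A̲s = b∈A̲s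
    ... | no  b∉A̲s = ⊥-elim (none (b , b∈Au , b∉A̲s))
  ... | yes (b , b∈Au , b∉A̲s) =
    x , proj₁ s∨b , rk-join-atom atom-b b≰s s∨b , independent⇒A̲⊆A̲ Sb-indep Sb⊆A̲u
    where
    atom-b = proj₁ (∈A⁻ b∈Au)
    b∉cl-s : ¬ InClosure s b
    b∉cl-s = b∉A̲s ∘ ∈A̲⁺ atom-b
    b≰s = b∉cl-s ∘ inj₁
    x = proj₁ (¬inClosure⇒join b∉cl-s)
    s∨b = proj₂ (¬inClosure⇒join b∉cl-s)
    S = proj₁ (basis s)
    S-indep = proj₂ (basis s)
    Sb-indep : Independent (S ∪ ⁅ b ⁆) x
    Sb-indep = independent-insert S-indep atom-b b≰s s∨b
    Sb⊆A̲u : ∀ {c} → c ∈ˢ S ∪ ⁅ b ⁆ → suc c ∈ˢ A̲ u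
    Sb⊆A̲u c∈ with x∈p∪⁅y⁆⁻ c∈
    ... | inj₁ c∈S  = A̲s⊆A̲u (A⊆A̲ (∈-basis⇒∈A S-indep c∈S))
    ... | inj₂ refl = A⊆A̲ b∈Au

  A̲⊂A̲⇒rk< : ∀ {s u} → A̲ s ⊆ˢ A̲ u → ¬ A̲ s ≡ A̲ u → rk s < rk u
  A̲⊂A̲⇒rk< {s} {u} A̲s⊆A̲u A̲s≢A̲u with A̲⊂A̲⇒step A̲s⊆A̲u A̲s≢A̲u
  ... | _ , _ , rkx≡1+rks , A̲x⊆A̲u = subst (_≤ rk u) rkx≡1+rks (A̲⊆A̲⇒rk≤ A̲x⊆A̲u)

  A̲-lowerCover : ∀ {s t} → A̲ s ⊆ˢ A̲ t → ¬ A̲ s ≡ A̲ t →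
                 ∃ λ x → A̲ s ⊆ˢ A̲ x × A̲ x ⊆ˢ A̲ t × ¬ A̲ x ≡ A̲ t × suc (rk x) ≡ rk t
  A̲-lowerCover {s} {t} = go (rk t) (ℕ.m≤n+m (rk t) (rk s))
    where
    go : ∀ n {s} → rk t ≤ rk s + n → A̲ s ⊆ˢ A̲ t → ¬ A̲ s ≡ A̲ t →
         ∃ λ x → A̲ s ⊆ˢ A̲ x × A̲ x ⊆ˢ A̲ t × ¬ A̲ x ≡ A̲ t × suc (rk x) ≡ rk t
    go n {s} bound A̲s⊆A̲t A̲s≢A̲t with A̲⊂A̲⇒step A̲s⊆A̲t A̲s≢A̲t
    ... | x , s≤x , rkx≡1+rks , A̲x⊆A̲t with A̲ x ≟ˢ A̲ t | n
    ...   | yes A̲x≡A̲t | _ = s , ⊆-refl , A̲s⊆A̲t , A̲s≢A̲t , trans (sym rkx≡1+rks) (A̲≡A̲⇒rk≡ A̲x≡A̲t)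
    ...   | no  A̲x≢A̲t | zero = ⊥-elim (ℕ.<-irrefl refl
            (ℕ.<-≤-trans (A̲⊂A̲⇒rk< A̲s⊆A̲t A̲s≢A̲t) (subst (rk t ≤_) (ℕ.+-identityʳ (rk s)) bound)))
    ...   | no  A̲x≢A̲t | suc n′
      with go n′ (subst (rk t ≤_) (trans (ℕ.+-suc (rk s) n′) (cong (_+ n′) (sym rkx≡1+rks))) bound) A̲x⊆A̲t A̲x≢A̲t
    ...     | y , A̲x⊆A̲y , rest = y , ⊆-trans (A̲-mono s≤x) A̲x⊆A̲y , rest

  rankM : ℕ
  rankM = maxℕ (map rk (allFin m))

  rk≤rankM : ∀ s → rk s ≤ rankM
  rk≤rankM s = maxℕ-upper (∈-map⁺ rk (∈-allFin s))

  top : ∃ λ x → rk x ≡ rankM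
  top with maxℕ-attained (map rk (allFin m))
  ... | inj₁ rankM≡0 = ⊥M , trans rk-⊥ (sym rankM≡0)
  ... | inj₂ rankM∈  with ∈-map⁻ rk rankM∈
  ...   | x , _ , rankM≡rkx = x , sym rankM≡rkx

  -- Augmenting against a basis of an element of maximal rank.
  extend-to-top : ∀ s → ∃ λ x → s ≤M x × rk x ≡ rankM
  extend-to-top s = go rankM (ℕ.m≤n+m rankM (rk s))
    where
    T-indep = proj₂ (basis (proj₁ top))
    go : ∀ n {s} → rankM ≤ rk s + n → ∃ λ x → s ≤M x × rk x ≡ rankM
    go n {s} bound with rk s ℕ.≟ rankM
    ... | yes rks≡rankM = s , ≤-refl , rks≡rankM
    ... | no  rks≢rankM with augmented _ _ T-indep s (subst (rk s <_) (sym (proj₂ top)) (ℕ.≤∧≢⇒< (rk≤rankM s) rks≢rankM)) | n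
    ...   | _ , _ , _ , _ , _ | zero =
      ⊥-elim (rks≢rankM (ℕ.≤-antisym (rk≤rankM s) (subst (rankM ≤_) (ℕ.+-identityʳ (rk s)) bound)))
    ...   | b , b∈T , b≰s , v , s∨b | suc n′
      with go n′ (subst (rankM ≤_) (trans (ℕ.+-suc (rk s) n′)
                                          (cong (_+ n′) (sym (rk-join-atom (independent-atom T-indep b∈T) b≰s s∨b))))
                        bound)
    ...     | x , v≤x , rkx≡rankM = x , ≤-trans (proj₁ s∨b) v≤x , rkx≡rankM

-- Characteristic polynomials

∸-∸-cancel : ∀ {a b} c → a ≤ b → (c ∸ a) ∸ (b ∸ a) ≡ c ∸ b
∸-∸-cancel {a} {b} c a≤b = trans (ℕ.∸-+-assoc c a (b ∸ a)) (cong (c ∸_) (ℕ.m+[n∸m]≡n a≤b))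

module CharacteristicPolynomials {m : ℕ} (M : RankedMeetSemilattice m) (G : IsGeometricSemilattice M) where

  open ConeProperties M G public

  μM : Fin m → ℤ
  μM = FP.μ Mposet ⊥M

  module Mᴾ = FinitePosetTheory Mposet isPartialOrder

  private
    rk-strictMonoᴹ : ∀ {y z} → y ∈ allFin m → z ∈ allFin m → z <M y → rk z < rk y
    rk-strictMonoᴹ _ _ = rk-strictMono

    rk-lowerCoverᴹ : ∀ {y} → y ∈ allFin m → rk y ≡ 0 ⊎ ∃ λ z → z ∈ allFin m × z <M y × suc (rk z) ≡ rk y
    rk-lowerCoverᴹ {y} _ with y ≟Fin ⊥M
    ... | yes refl = inj₁ rk-⊥
    ... | no  y≢⊥ with lowerCover (⊥M-min y , y≢⊥ ∘ sym)
    ...   | z , _ , z⋖y@(z≤y , z≢y , _) = inj₂ (z , ∈-allFin z , (z≤y , z≢y) , sym (rk-⋖ z⋖y))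

  module rkᴹ = Mᴾ.RankFunction rk rk-strictMonoᴹ rk-lowerCoverᴹ

  χ-M : ∀ t → FP.χ Mposet ⊥M t ≡ ∑ (allFin m) (λ s → μM s *ℤ t ^ℤ (rankM ∸ rk s))
  χ-M t = ∑-cong (allFin m) (λ {s} s∈ → cong (λ k → μM s *ℤ t ^ℤ k) (cong₂ _∸_ rkᴹ.rankP≡max-r (rkᴹ.rank≡r s∈)))

  C : List (Subset (suc m))
  C = centralElems

  C-unique : Unique C
  C-unique = Unique.filter⁺ inCentral? {xs = allSubsets (suc m)} (allSubsets-unique (suc m))

  ∈C⁻ : ∀ {T} → T ∈ C → ∃ λ s → T ≡ A̲ s
  ∈C⁻ T∈C = proj₂ (∈-filter⁻ inCentral? {xs = allSubsets (suc m)} T∈C)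

  A̲∈C : ∀ s → A̲ s ∈ C
  A̲∈C s = ∈-filter⁺ inCentral? {xs = allSubsets (suc m)} (∈-allSubsets (A̲ s)) (s , refl)

  module Cᴾ = FinitePosetTheory (subsetPoset C) (⊆-isPartialOrder (suc m))

  μC : Subset (suc m) → Subset (suc m) → ℤ
  μC = FP.μ (subsetPoset C)

  -- The rank of A̲ s in the cone is rk s + 1; the value 0 off the centralization is never used.
  centralRank : Subset (suc m) → ℕ
  centralRank T with inCentral? T
  ... | yes (s , _) = suc (rk s)
  ... | no  _       = 0

  centralRank-A̲ : ∀ s → centralRank (A̲ s) ≡ suc (rk s)
  centralRank-A̲ s with inCentral? (A̲ s)
  ... | yes (s′ , A̲s≡A̲s′) = cong suc (A̲≡A̲⇒rk≡ (sym A̲s≡A̲s′))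
  ... | no  not-central   = ⊥-elim (not-central (s , refl))

  centralRank≤ : ∀ T → centralRank T ≤ suc rankM
  centralRank≤ T with inCentral? T
  ... | yes (s , _) = s≤s (rk≤rankM s)
  ... | no  _       = z≤n

  codim : Subset (suc m) → ℕ
  codim T = suc rankM ∸ centralRank T

  module Filter (s : Fin m) where

    module R = Restriction (subsetPoset C) (⊆-isPartialOrder (suc m)) (A̲ s ⊆?_)
    module F = R.R

    ∈F⁻ : ∀ {T} → T ∈ F.elements → ∃ λ t → T ≡ A̲ t × A̲ s ⊆ˢ A̲ t
    ∈F⁻ T∈F with ∈-filter⁻ (A̲ s ⊆?_) T∈F
    ... | T∈C , A̲s⊆T with ∈C⁻ T∈C
    ...   | t , refl = t , refl , A̲s⊆T

    A̲∈F : ∀ {t} → A̲ s ⊆ˢ A̲ t → A̲ t ∈ F.elements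
    A̲∈F {t} = ∈-filter⁺ (A̲ s ⊆?_) (A̲∈C t)

    r : Subset (suc m) → ℕ
    r T = centralRank T ∸ suc (rk s)

    r-A̲ : ∀ t → r (A̲ t) ≡ rk t ∸ rk s
    r-A̲ t = cong (_∸ suc (rk s)) (centralRank-A̲ t)

    private
      r-strictMono : ∀ {Y Z} → Y ∈ F.elements → Z ∈ F.elements → Z F.≺ Y → r Z < r Y
      r-strictMono Y∈ Z∈ (Z⊆Y , Z≢Y) with ∈F⁻ Y∈ | ∈F⁻ Z∈
      ... | y , refl , _ | z , refl , A̲s⊆A̲z =
        subst₂ _<_ (sym (r-A̲ z)) (sym (r-A̲ y)) (ℕ.∸-monoˡ-< (A̲⊂A̲⇒rk< Z⊆Y Z≢Y) (A̲⊆A̲⇒rk≤ A̲s⊆A̲z))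

      r-lowerCover : ∀ {Y} → Y ∈ F.elements → r Y ≡ 0 ⊎ ∃ λ Z → Z ∈ F.elements × Z F.≺ Y × suc (r Z) ≡ r Y
      r-lowerCover Y∈ with ∈F⁻ Y∈
      ... | y , refl , A̲s⊆A̲y with A̲ s ≟ˢ A̲ y
      ...   | yes A̲s≡A̲y = inj₁ (trans (r-A̲ y) (trans (cong (rk y ∸_) (A̲≡A̲⇒rk≡ A̲s≡A̲y)) (ℕ.n∸n≡0 (rk y))))
      ...   | no  A̲s≢A̲y with A̲-lowerCover A̲s⊆A̲y A̲s≢A̲y
      ...     | x , A̲s⊆A̲x , A̲x⊆A̲y , A̲x≢A̲y , 1+rkx≡rky =
        inj₂ (A̲ x , A̲∈F A̲s⊆A̲x , (A̲x⊆A̲y , A̲x≢A̲y) , (begin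
        suc (r (A̲ x))          ≡⟨ cong suc (r-A̲ x) ⟩
        suc (rk x ∸ rk s)      ≡⟨ sym (ℕ.+-∸-assoc 1 (A̲⊆A̲⇒rk≤ A̲s⊆A̲x)) ⟩
        suc (rk x) ∸ rk s      ≡⟨ cong (_∸ rk s) 1+rkx≡rky ⟩
        rk y ∸ rk s            ≡⟨ sym (r-A̲ y) ⟩
        r (A̲ y)                ∎))

    module rᶠ = F.RankFunction r r-strictMono r-lowerCover

    rankF : F.rankP ≡ rankM ∸ rk s
    rankF = trans rᶠ.rankP≡max-r (ℕ.≤-antisym (maxℕ-least (map r F.elements) upper) lower)
      where
      upper : ∀ {n} → n ∈ map r F.elements → n ≤ rankM ∸ rk s
      upper n∈ with ∈-map⁻ r n∈
      ... | T , _ , refl = ℕ.∸-monoˡ-≤ (suc (rk s)) (centralRank≤ T)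
      lower : rankM ∸ rk s ≤ maxℕ (map r F.elements)
      lower with extend-to-top s
      ... | x , s≤x , rkx≡rankM = subst (_≤ maxℕ (map r F.elements)) (trans (r-A̲ x) (cong (_∸ rk s) rkx≡rankM))
                                       (maxℕ-upper (∈-map⁺ r (A̲∈F (A̲-mono s≤x))))

    codim-F : ∀ {T} → T ∈ F.elements → F.rankP ∸ F.rank T ≡ codim T
    codim-F {T} T∈ with ∈F⁻ T∈
    ... | t , refl , A̲s⊆A̲t = begin
      F.rankP ∸ F.rank (A̲ t)
        ≡⟨ cong₂ _∸_ rankF (rᶠ.rank≡r T∈) ⟩
      (rankM ∸ rk s) ∸ (centralRank (A̲ t) ∸ suc (rk s))
        ≡⟨ ∸-∸-cancel (suc rankM) (subst (suc (rk s) ≤_) (sym (centralRank-A̲ t)) (s≤s (A̲⊆A̲⇒rk≤ A̲s⊆A̲t))) ⟩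
      codim (A̲ t) ∎

    χ-filter : ∀ t → FP.χ (filterPoset (A̲ s)) (A̲ s) t ≡ ∑ C (λ T → when (A̲ s ⊆? T) (μC (A̲ s) T *ℤ t ^ℤ codim T))
    χ-filter t = begin
      FP.χ (filterPoset (A̲ s)) (A̲ s) t
        ≡⟨ cong (λ L → FP.χ (subsetPoset L) (A̲ s) t) (sym (filter-filter (A̲ s ⊆?_) inCentral? (allSubsets (suc m)))) ⟩
      ∑ F.elements (λ T → F.μ (A̲ s) T *ℤ t ^ℤ (F.rankP ∸ F.rank T))
        ≡⟨ ∑-cong F.elements (λ T∈ → cong₂ _*ℤ_ (R.μ-restrict id T∈) (cong (t ^ℤ_) (codim-F T∈))) ⟩
      ∑ F.elements (λ T → μC (A̲ s) T *ℤ t ^ℤ codim T)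
        ≡⟨ ∑-filter (A̲ s ⊆?_) C _ ⟩
      ∑ C (λ T → when (A̲ s ⊆? T) (μC (A̲ s) T *ℤ t ^ℤ codim T)) ∎

  χ-filter : ∀ {S} → S ∈ C → ∀ t → FP.χ (filterPoset S) S t ≡ ∑ C (λ T → when (S ⊆? T) (μC S T *ℤ t ^ℤ codim T))
  χ-filter S∈C with ∈C⁻ S∈C
  ... | s , refl = Filter.χ-filter s

  module Local (S : Subset (suc m)) where

    module E = OrderEmbedding Mposet (localPoset S) isPartialOrder (⊆-isPartialOrder (suc m)) A A-injective A-mono A-reflects
    module L = E.Q

    private
      inLocal? : (X : Subset (suc m)) → Dec (InCone X × X ⊆ˢ S × ¬ InCentral X)
      inLocal? X = inCone? X ×-dec ((X ⊆? S) ×-dec ¬? (inCentral? X))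

    ∈L⁻ : ∀ {X} → X ∈ L.elements → ∃ λ s → X ≡ A s × A s ⊆ˢ S
    ∈L⁻ X∈L with proj₂ (∈-filter⁻ inLocal? {xs = allSubsets (suc m)} X∈L)
    ... | (s , inj₁ refl) , As⊆S , _ = s , refl , As⊆S
    ... | (s , inj₂ refl) , _ , not-central = ⊥-elim (not-central (s , refl))

    A∈L : ∀ {s} → A s ⊆ˢ S → A s ∈ L.elements
    A∈L {s} As⊆S = ∈-filter⁺ inLocal? (∈-allSubsets (A s)) ((s , inj₁ refl) , As⊆S , λ ())

    L-unique : Unique L.elements
    L-unique = Unique.filter⁺ inLocal? {xs = allSubsets (suc m)} (allSubsets-unique (suc m))

    Below : Fin m → Set
    Below z = A z ⊆ˢ S

    below? : (z : Fin m) → Dec (Below z)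
    below? z = A z ⊆? S

    interval-Below : ∀ {z w} → Below z → w ∈ E.P.interval ⊥M z → Below w
    interval-Below Az⊆S w∈ = ⊆-trans (A-mono (proj₁ (proj₂ (proj₂ (E.P.interval⁻ w∈))))) Az⊆S

    interval-image : ∀ {z} → Below z → L.interval (A ⊥M) (A z) ↭ map A (E.P.interval ⊥M z)
    interval-image {z} Az⊆S = same-members⇒↭ (Unique.filter⁺ _ L-unique)
                                              (Unique.map⁺ A-injective (Unique.filter⁺ _ (Unique.allFin⁺ m))) to from
      where
      to : ∀ {W} → W ∈ L.interval (A ⊥M) (A z) → W ∈ map A (E.P.interval ⊥M z)
      to W∈ with L.interval⁻ W∈
      ... | W∈L , _ , W⊆Az , W≢Az with ∈L⁻ W∈L
      ...   | w , refl , _ = ∈-map⁺ A (E.P.interval⁺ (∈-allFin w) (⊥M-min w) (A-reflects W⊆Az , λ { refl → W≢Az refl }))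
      from : ∀ {W} → W ∈ map A (E.P.interval ⊥M z) → W ∈ L.interval (A ⊥M) (A z)
      from W∈ with ∈-map⁻ A W∈
      ... | w , w∈ , refl with E.P.interval⁻ w∈
      ...   | _ , _ , w≤z , w≢z =
        L.interval⁺ (A∈L (⊆-trans (A-mono w≤z) Az⊆S)) (A-mono (⊥M-min w)) (A-mono w≤z , w≢z ∘ A-injective)

    elements-image : L.elements ↭ map A (filter below? (allFin m))
    elements-image = same-members⇒↭ L-unique (Unique.map⁺ A-injective (Unique.filter⁺ below? (Unique.allFin⁺ m))) to from
      where
      to : ∀ {X} → X ∈ L.elements → X ∈ map A (filter below? (allFin m))
      to X∈L with ∈L⁻ X∈L
      ... | s , refl , As⊆S = ∈-map⁺ A (∈-filter⁺ below? (∈-allFin s) As⊆S)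
      from : ∀ {X} → X ∈ map A (filter below? (allFin m)) → X ∈ L.elements
      from X∈ with ∈-map⁻ A X∈
      ... | s , s∈ , refl = A∈L (proj₂ (∈-filter⁻ below? {xs = allFin m} s∈))

    μL≡μM : ∀ {s} → Below s → L.μ ∅ (A s) ≡ μM s
    μL≡μM {s} As⊆S = trans (cong (λ X → L.μ X (A s)) (sym A⊥≡∅))
                           (E.μ-image ⊥M Below interval-image interval-Below As⊆S (∈-allFin s) (A∈L As⊆S))

    χ-local : FP.χ (localPoset S) ∅ 1ℤ ≡ ∑ (allFin m) (λ s → when (A s ⊆? S) (μM s))
    χ-local = begin
      FP.χ (localPoset S) ∅ 1ℤ
        ≡⟨ ∑-cong L.elements (λ {X} _ → trans (cong (L.μ ∅ X *ℤ_) (ℤ.^-zeroˡ (L.rankP ∸ L.rank X)))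
                                              (ℤ.*-identityʳ (L.μ ∅ X))) ⟩
      ∑ L.elements (L.μ ∅)
        ≡⟨ ∑-↭ (L.μ ∅) elements-image ⟩
      ∑ (map A (filter below? (allFin m))) (L.μ ∅)
        ≡⟨ ∑-map (filter below? (allFin m)) A (L.μ ∅) ⟩
      ∑ (filter below? (allFin m)) (L.μ ∅ ∘ A)
        ≡⟨ ∑-cong (filter below? (allFin m)) (μL≡μM ∘ proj₂ ∘ ∈-filter⁻ below? {xs = allFin m}) ⟩
      ∑ (filter below? (allFin m)) μM
        ≡⟨ ∑-filter below? (allFin m) μM ⟩
      ∑ (allFin m) (λ s → when (A s ⊆? S) (μM s)) ∎

  open Local using (χ-local) public

  ∑-μC-between : ∀ s {T} → T ∈ C → ∑ C (λ S → when (A s ⊆? S) (when (S ⊆? T) (μC S T))) ≡ when (A̲ s ≟ˢ T) 1ℤ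
  ∑-μC-between s {T} T∈C = trans (∑-cong C (λ {S} S∈C → when-⇔ (A s ⊆? S) (A̲ s ⊆? S) (closure S∈C) (⊆-trans A⊆A̲) _))
                                 (Cᴾ.μ-dual-recursion C-unique (A̲∈C s) T∈C)
    where
    closure : ∀ {S} → S ∈ C → A s ⊆ˢ S → A̲ s ⊆ˢ S
    closure S∈C with ∈C⁻ S∈C
    ... | _ , refl = A⊆A̲⇒A̲⊆A̲

  collapse : ∀ t → ∑ C (λ S → ∑ C (λ T → when (S ⊆? T) (μC S T *ℤ t ^ℤ codim T))
                              *ℤ ∑ (allFin m) (λ s → when (A s ⊆? S) (μM s)))
                   ≡ ∑ (allFin m) (λ s → μM s *ℤ t ^ℤ (rankM ∸ rk s))
  collapse t = begin
    ∑ C (λ S → ∑ C (f S) *ℤ ∑ (allFin m) (g S))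
      ≡⟨ ∑-cong C (λ {S} _ → ∑-*-∑ C (allFin m) (f S) (g S)) ⟩
    ∑ C (λ S → ∑ C (λ T → ∑ (allFin m) (λ s → f S T *ℤ g S s)))
      ≡⟨ ∑-swap₃ C C (allFin m) _ ⟩
    ∑ (allFin m) (λ s → ∑ C (λ T → ∑ C (λ S → f S T *ℤ g S s)))
      ≡⟨ ∑-cong (allFin m) (λ {s} _ → ∑-cong C (sum-over-S s)) ⟩
    ∑ (allFin m) (λ s → ∑ C (λ T → (μM s *ℤ t ^ℤ codim T) *ℤ when (A̲ s ≟ˢ T) 1ℤ))
      ≡⟨ ∑-cong (allFin m) (λ {s} _ → sum-over-T s) ⟩
    ∑ (allFin m) (λ s → μM s *ℤ t ^ℤ (rankM ∸ rk s)) ∎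
    where
    f : Subset (suc m) → Subset (suc m) → ℤ
    f S T = when (S ⊆? T) (μC S T *ℤ t ^ℤ codim T)
    g : Subset (suc m) → Fin m → ℤ
    g S s = when (A s ⊆? S) (μM s)
    sum-over-S : ∀ s {T} → T ∈ C → ∑ C (λ S → f S T *ℤ g S s) ≡ (μM s *ℤ t ^ℤ codim T) *ℤ when (A̲ s ≟ˢ T) 1ℤ
    sum-over-S s {T} T∈C = begin
      ∑ C (λ S → f S T *ℤ g S s)
        ≡⟨ ∑-cong C (λ {S} _ → when-*-when (S ⊆? T) (A s ⊆? S) (μC S T) (t ^ℤ codim T) (μM s)) ⟩
      ∑ C (λ S → (μM s *ℤ t ^ℤ codim T) *ℤ when (A s ⊆? S) (when (S ⊆? T) (μC S T)))
        ≡⟨ sym (∑-*ˡ C (μM s *ℤ t ^ℤ codim T) _) ⟩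
      (μM s *ℤ t ^ℤ codim T) *ℤ ∑ C (λ S → when (A s ⊆? S) (when (S ⊆? T) (μC S T)))
        ≡⟨ cong ((μM s *ℤ t ^ℤ codim T) *ℤ_) (∑-μC-between s T∈C) ⟩
      (μM s *ℤ t ^ℤ codim T) *ℤ when (A̲ s ≟ˢ T) 1ℤ ∎
    sum-over-T : ∀ s → ∑ C (λ T → (μM s *ℤ t ^ℤ codim T) *ℤ when (A̲ s ≟ˢ T) 1ℤ) ≡ μM s *ℤ t ^ℤ (rankM ∸ rk s)
    sum-over-T s = begin
      ∑ C (λ T → (μM s *ℤ t ^ℤ codim T) *ℤ when (A̲ s ≟ˢ T) 1ℤ)
        ≡⟨ ∑-single C-unique (A̲∈C s) (λ {T} _ T≢A̲s →
             trans (cong ((μM s *ℤ t ^ℤ codim T) *ℤ_) (when-no (A̲ s ≟ˢ T) (T≢A̲s ∘ sym) 1ℤ))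
                   (ℤ.*-zeroʳ (μM s *ℤ t ^ℤ codim T))) ⟩
      (μM s *ℤ t ^ℤ codim (A̲ s)) *ℤ when (A̲ s ≟ˢ A̲ s) 1ℤ
        ≡⟨ trans (cong ((μM s *ℤ t ^ℤ codim (A̲ s)) *ℤ_) (when-yes (A̲ s ≟ˢ A̲ s) refl 1ℤ)) (ℤ.*-identityʳ _) ⟩
      μM s *ℤ t ^ℤ codim (A̲ s)
        ≡⟨ cong (λ k → μM s *ℤ t ^ℤ (suc rankM ∸ k)) (centralRank-A̲ s) ⟩
      μM s *ℤ t ^ℤ (rankM ∸ rk s) ∎

theorem1p4 : (m : ℕ) (M : RankedMeetSemilattice m) → IsGeometricSemilattice M →
  (t : ℤ) →
  FP.χ (Cone.Mposet M) (RankedMeetSemilattice.⊥M M) t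
    ≡ sumℤ (map (λ S → FP.χ (Cone.filterPoset M S) S t
                        *ℤ FP.χ (Cone.localPoset M S) ∅ 1ℤ)
                (Cone.centralElems M))
theorem1p4 m M G t = begin
  FP.χ Mposet ⊥M t
    ≡⟨ χ-M t ⟩
  ∑ (allFin m) (λ s → μM s *ℤ t ^ℤ (rankM ∸ rk s))
    ≡⟨ sym (collapse t) ⟩
  ∑ C (λ S → ∑ C (λ T → when (S ⊆? T) (μC S T *ℤ t ^ℤ codim T)) *ℤ ∑ (allFin m) (λ s → when (A s ⊆? S) (μM s)))
    ≡⟨ sym (∑-cong C (λ {S} S∈C → cong₂ _*ℤ_ (χ-filter S∈C t) (χ-local S))) ⟩
  ∑ C (λ S → FP.χ (filterPoset S) S t *ℤ FP.χ (localPoset S) ∅ 1ℤ)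
    ∎
  where open CharacteristicPolynomials M G
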